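{- In the folding setting described in the context, let $K\in Z^+(\mathfrak{g}(A))$, $v\in W_A$ and $i\in I$ with $v\prec w=s_iv$ in the left weak order, and fix any $j\in O_i$. Then $$n^A_K(v,s_iv)=n^B_{\varphi(K)}(f(v),s_jf(v))=n^B_{\varphi(K)}(s_jf(w),f(w)),$$ i.e. the number of marked edges $v\to w$ in $\Gamma_w^A(K)$, the number of marked edges $f(v)\to s_jf(v)$ in $\Gamma_w^B(\varphi(K))$, and the number of marked edges $s_jf(w)\to f(w)$ in $\Gamma_w^B(\varphi(K))$ coincide.
   Context: Let $B=(b_{jk})_{j,k\in J}$ be a generalized Cartan matrix (GCM), $\pi$ an admissible automorphism of $B$ (permutation of $J$ with $b_{\pi(j)\pi(k)}=b_{jk}$ and $b_{jk}=0$ for $j,k$ in the same orbit), $I$ indexing the $\pi$-orbits $O_i$, $o_i=|O_i|$, $A$ the GCM $a_{i'i}=\frac{o_{i'}}{o_i}\sum_{j\in O_i}b_{j'j}$ ($j'\in O_{i'}$). $\alpha_i^\vee$ and $\beta_j^\vee$ are the simple coroots of $\mathfrak{g}(A)$, $\mathfrak{g}(B)$; $W_A,W_B$ the Weyl groups; $f:W_A\to W_B$ the injective homomorphism $f(s_i^A)=\prod_{j\in O_i}s_j^B$. $\varphi$ is the linear map from the coroot lattice of $\mathfrak{g}(A)$ to that of $\mathfrak{g}(B)$ with $\varphi(\alpha_i^\vee)=\sum_{j\in O_i}\beta_j^\vee$. $Z^+(\mathfrak{g})=Z(\mathfrak{g})\cap\bigoplus\mathbb{Z}_{\ge0}(\text{simple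 coroots})$ with $Z(\mathfrak{g})$ the center ($\varphi$ maps $Z^+(\mathfrak{g}(A))$ into $Z^+(\mathfrak{g}(B))$). For $K=\sum_kk_k\alpha_k^\vee\in Z^+$, the weak graph $\Gamma_w(K)$ has vertex set the Weyl group and an edge $x\to s_kx$ for each left weak cover $x\prec s_kx$ (i.e. $\ell(s_kx)=\ell(x)+1$) of multiplicity $n_K(x,s_kx)=k_k$; superscripts indicate the algebra. -}

module Defs where

open import Data.Nat as ℕ using (ℕ; zero; suc)
open import Data.Integer as ℤ using (ℤ; +_; _-_; _*_; _+_; _≤_)
open import Data.Fin using (Fin; zero; suc; _≟_)
open import Data.Fin.Permutation using (Permutation′; _⟨$⟩ʳ_)
open import Data.List using (List; []; _∷_; length; filter; allFin; concatMap; foldr)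
open import Data.Product using (Σ; Σ-syntax; ∃; ∃-syntax; _×_; _,_)
open import Data.Sum using (_⊎_)
open import Relation.Nullary using (¬_; does)
open import Relation.Binary.PropositionalEquality using (_≡_; _≢_)
open import Data.Bool using (if_then_else_)

sumℤ : ∀ {m} → (Fin m → ℤ) → ℤ
sumℤ {zero}  g = + 0
sumℤ {suc m} g = g zero + sumℤ (λ t → g (suc t))

orbitSum : ∀ {m n} → (Fin m → Fin n) → Fin n → (Fin m → ℤ) → ℤ
orbitSum ρ i g = sumℤ (λ j → if does (ρ j ≟ i) then g j else + 0)

orbitSize : ∀ {m n} → (Fin m → Fin n) → Fin n → ℕ
orbitSize {zero}  ρ i = 0
orbitSize {suc m} ρ i =
  (if does (ρ zero ≟ i) then 1 else 0) ℕ.+ orbitSize (λ t → ρ (suc t)) i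

orbitList : ∀ {m n} → (Fin m → Fin n) → Fin n → List (Fin m)
orbitList ρ i = filter (λ j → ρ j ≟ i) (allFin _)

Matrix : ℕ → Set
Matrix m = Fin m → Fin m → ℤ

record IsGCM {m : ℕ} (C : Matrix m) : Set where
  field
    diag    : ∀ j → C j j ≡ + 2
    offdiag : ∀ j k → j ≢ k → C j k ≤ + 0
    zero-sym : ∀ j k → C j k ≡ + 0 → C k j ≡ + 0

-- Weyl group W(C), realised by its (faithful) action on the root lattice
-- Q = ⊕ ℤ α_j.  An element of Q is its coordinate vector Fin m → ℤ.
-- Elements of W(C) are words in the simple reflections, the word
-- k₁ ∷ … ∷ kᵣ standing for s_{k₁} ⋯ s_{kᵣ}; two words are equal as Weyl
-- group elements iff they act identically on Q.

Word : ℕ → Set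
Word m = List (Fin m)

-- s_k λ = λ - ⟨λ, α_k^∨⟩ α_k, with ⟨α_j, α_k^∨⟩ = C k j
sref : ∀ {m} → Matrix m → Fin m → (Fin m → ℤ) → (Fin m → ℤ)
sref C k μ t = if does (t ≟ k) then μ t - sumℤ (λ j → C k j * μ j) else μ t

act : ∀ {m} → Matrix m → Word m → (Fin m → ℤ) → (Fin m → ℤ)
act C w μ = foldr (sref C) μ w

_≈[_]_ : ∀ {m} → Word m → Matrix m → Word m → Set
u ≈[ C ] w = ∀ μ t → act C u μ t ≡ act C w μ t

HasLength : ∀ {m} → Matrix m → Word m → ℕ → Set
HasLength C w n =
  (Σ[ u ∈ Word _ ] (length u ≡ n × u ≈[ C ] w)) ×
  (∀ (u : Word _) → u ≈[ C ] w → n ℕ.≤ length u)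

Cover : ∀ {m} → Matrix m → Word m → Fin m → Set
Cover C x k = Σ[ l ∈ ℕ ] (HasLength C x l × HasLength C (k ∷ x) (suc l))

-- Multiplicity n_K(x, y) of the edge x → y in the weak graph Γ_w(K)
-- (K = Σ K_k α_k^∨ given by its coefficients): it is K_k if y = s_k x
-- with x ≺ s_k x, and 0 if there is no such edge.
EdgeMult : ∀ {m} → Matrix m → (Fin m → ℕ) → Word m → Word m → ℕ → Set
EdgeMult C K x y c =
  (Σ[ k ∈ Fin _ ] (y ≈[ C ] (k ∷ x) × Cover C x k × c ≡ K k)) ⊎
  ((¬ (Σ[ k ∈ Fin _ ] (y ≈[ C ] (k ∷ x) × Cover C x k))) × c ≡ 0)

-- Z^+(g(C)) : K = Σ K_k α_k^∨ with K_k ≥ 0 and α_i(K) = Σ_k K_k C k i = 0 ∀ i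
InZPlus : ∀ {m} → Matrix m → (Fin m → ℕ) → Set
InZPlus C K = ∀ i → sumℤ (λ k → (+ K k) * C k i) ≡ + 0

iter : ∀ {m} → Permutation′ m → ℕ → Fin m → Fin m
iter π zero    j = j
iter π (suc t) j = π ⟨$⟩ʳ iter π t j

record Folding (m n : ℕ) : Set where
  field
    B       : Matrix m
    B-GCM   : IsGCM B
    π       : Permutation′ m
    π-auto  : ∀ j k → B (π ⟨$⟩ʳ j) (π ⟨$⟩ʳ k) ≡ B j k
    -- I = Fin n indexes the π-orbits via ρ : J → I, O_i = ρ⁻¹(i)
    ρ       : Fin m → Fin n
    ρ-surj  : ∀ i → ∃[ j ] ρ j ≡ i
    ρ-orbit : ∀ j k → (ρ j ≡ ρ k → ∃[ t ] iter π t j ≡ k)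
                    × ((∃[ t ] iter π t j ≡ k) → ρ j ≡ ρ k)
    π-admissible : ∀ j k → ρ j ≡ ρ k → j ≢ k → B j k ≡ + 0
    -- the folded matrix: a_{i'i} = (o_{i'}/o_i) Σ_{j∈O_i} b_{j'j}, j' ∈ O_{i'}
    A       : Matrix n
    A-def   : ∀ i' i j' → ρ j' ≡ i' →
              (+ orbitSize ρ i) * A i' i ≡ (+ orbitSize ρ i') * orbitSum ρ i (B j')

  f : Word n → Word m
  f = concatMap (orbitList ρ)

  -- φ : coroot lattice of g(A) → that of g(B), φ(α_i^∨) = Σ_{j∈O_i} β_j^∨
  φ : (Fin n → ℕ) → (Fin m → ℕ)
  φ K j = K (ρ j)

-- A left weak cover x ≺ s_k x holds exactly when x⁻¹ α_k is a positive root; this is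
-- Humphreys' theorem ℓ(w s) > ℓ(w) ⇔ w α_s > 0, proved by reduction to rank two, where the
-- finite dihedral types are settled by computation and the infinite ones by an invariant.
-- Under folding, f(s_k) is the product of the commuting reflections s_j, j ∈ O_k, and the
-- action of f(v)⁻¹ on orbit-constant vectors of the root lattice of B lifts the action of
-- v⁻¹ on that of A. Hence v⁻¹ α_i > 0 forces f(v)⁻¹ β_j > 0: otherwise, by π-equivariance,
-- every f(v)⁻¹ β_j' (j' ∈ O_i) would be ≤ 0 while their sum lifts o_i v⁻¹ α_i ≥ 0. Moreover
-- the reflections of O_i send s_j β_j = -β_j back to β_j, so (s_j f(s_i v))⁻¹ β_j = f(v)⁻¹ β_j.
-- All three edges therefore exist and carry the multiplicity K_i = φ(K)_j.
module Submission where

open import Defs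
open import Data.Nat using (ℕ)
open import Data.Fin using (Fin)
open import Data.List using (_∷_)
open import Data.Product using (Σ-syntax; _×_)
open import Relation.Binary.PropositionalEquality using (_≡_)

import Algebra.Properties.Semiring.Sum as Sum
open import Data.Bool using (Bool; true; false; not; if_then_else_)
import Data.Bool.Properties as Boolₚ
open import Data.Empty using (⊥-elim)
open import Data.Fin using (zero; suc; _≟_)
import Data.Fin.Properties as Finₚ
open import Data.Fin.Permutation using (Permutation′; _⟨$⟩ʳ_; _⟨$⟩ˡ_; inverseˡ; inverseʳ)
open import Data.Integer as ℤ using (ℤ; +_; +0; -[1+_]; +[1+_]; -_; _-_; _*_; _+_)
import Data.Integer.Properties as ℤₚ
open import Data.Integer.Tactic.RingSolver using (solve-∀)
open import Data.List using (List; []; _++_; [_]; length; reverse; map; initLast; _∷ʳ′_; allFin)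
open import Data.List.Membership.Propositional using (_∈_; _∉_)
open import Data.List.Membership.Propositional.Properties using (∈-filter⁺; ∈-filter⁻; ∈-allFin)
open import Data.List.Properties
  using (foldr-++; foldr-∷ʳ; reverse-foldr; unfold-reverse; reverse-++; reverse-involutive;
         length-reverse; length-++; length-map; map-++; ++-assoc; ++-identityʳ; ∷-injectiveˡ)
open import Data.List.Relation.Unary.All as All using (All; []; _∷_)
import Data.List.Relation.Unary.All.Properties as Allₚ
open import Data.List.Relation.Unary.AllPairs using (_∷_)
open import Data.List.Relation.Unary.Any using (here; there)
open import Data.List.Relation.Unary.Unique.Propositional using (Unique)
import Data.List.Relation.Unary.Unique.Propositional.Properties as Uniqueₚ
open import Data.Nat as ℕ using (zero; suc; z≤n; s≤s)
import Data.Nat.Properties as ℕₚ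
open import Data.Product using (Σ; ∃; _,_; proj₁; proj₂)
open import Data.Sum using (_⊎_; inj₁; inj₂)
open import Function using (_∘_)
open import Relation.Binary.Bundles using (Setoid)
open import Relation.Binary.PropositionalEquality
  using (_≢_; refl; sym; trans; cong; cong₂; subst; subst₂; _≗_; module ≡-Reasoning)
import Relation.Binary.Reasoning.Setoid as SetoidReasoning
open import Relation.Nullary using (¬_; Dec; yes; no; does)
open import Relation.Nullary.Decidable using (map′; True; toWitness; _×-dec_)

nonNeg-* : ∀ {x y} → +0 ℤ.≤ x → +0 ℤ.≤ y → +0 ℤ.≤ x * y
nonNeg-* {x} {y} 0≤x 0≤y =
  subst (ℤ._≤ x * y) (ℤₚ.*-zeroʳ x) (ℤₚ.*-monoˡ-≤-nonNeg x {{ℤ.nonNegative 0≤x}} 0≤y)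

nonNeg-neg⇒nonPos : ∀ {x} → +0 ℤ.≤ - x → x ℤ.≤ +0
nonNeg-neg⇒nonPos {x} 0≤-x = subst (ℤ._≤ +0) (ℤₚ.neg-involutive x) (ℤₚ.neg-mono-≤ 0≤-x)

*-cancel-pos : ∀ {p} → 1 ℕ.≤ p → ∀ {x y} → + p * x ≡ + p * y → x ≡ y
*-cancel-pos {suc p} _ {x} {y} = ℤₚ.*-cancelˡ-≡ +[1+ p ] x y

*-nonNeg⁻¹ : ∀ {p} → 1 ℕ.≤ p → ∀ {x} → +0 ℤ.≤ + p * x → +0 ℤ.≤ x
*-nonNeg⁻¹ {suc p} _ {x} 0≤px =
  ℤₚ.*-cancelˡ-≤-pos +0 x +[1+ p ] (subst (ℤ._≤ +[1+ p ] * x) (sym (ℤₚ.*-zeroʳ +[1+ p ])) 0≤px)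

*-nonPos⁻¹ : ∀ {p} → 1 ℕ.≤ p → ∀ {x} → + p * x ℤ.≤ +0 → x ℤ.≤ +0
*-nonPos⁻¹ {suc p} _ {x} px≤0 =
  ℤₚ.*-cancelˡ-≤-pos x +0 +[1+ p ] (subst (+[1+ p ] * x ℤ.≤_) (sym (ℤₚ.*-zeroʳ +[1+ p ])) px≤0)

*-nonPos : ∀ p {x} → x ℤ.≤ +0 → + p * x ℤ.≤ +0
*-nonPos p {x} x≤0 = subst (+ p * x ℤ.≤_) (ℤₚ.*-zeroʳ (+ p)) (ℤₚ.*-monoˡ-≤-nonNeg (+ p) x≤0)

module ΣZ = Sum ℤₚ.+-*-semiring

sumℤ≡sum : ∀ {m} (g : Fin m → ℤ) → sumℤ g ≡ ΣZ.sum g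
sumℤ≡sum {zero}  g = refl
sumℤ≡sum {suc m} g = cong (_+_ (g zero)) (sumℤ≡sum (g ∘ suc))

sumℤ-cong : ∀ {m} {g h : Fin m → ℤ} → g ≗ h → sumℤ g ≡ sumℤ h
sumℤ-cong {zero}  eq = refl
sumℤ-cong {suc m} eq = cong₂ _+_ (eq zero) (sumℤ-cong (eq ∘ suc))

sumℤ-distrib-+ : ∀ {m} (g h : Fin m → ℤ) → sumℤ (λ t → g t + h t) ≡ sumℤ g + sumℤ h
sumℤ-distrib-+ g h = begin
  sumℤ (λ t → g t + h t)   ≡⟨ sumℤ≡sum (λ t → g t + h t) ⟩
  ΣZ.sum (λ t → g t + h t) ≡⟨ ΣZ.∑-distrib-+ g h ⟩
  ΣZ.sum g + ΣZ.sum h      ≡⟨ cong₂ _+_ (sumℤ≡sum g) (sumℤ≡sum h) ⟨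
  sumℤ g + sumℤ h          ∎
  where open ≡-Reasoning

sumℤ-distribˡ-* : ∀ {m} (c : ℤ) (g : Fin m → ℤ) → sumℤ (λ t → c * g t) ≡ c * sumℤ g
sumℤ-distribˡ-* c g = begin
  sumℤ (λ t → c * g t)   ≡⟨ sumℤ≡sum (λ t → c * g t) ⟩
  ΣZ.sum (λ t → c * g t) ≡⟨ ΣZ.*-distribˡ-sum c g ⟨
  c * ΣZ.sum g           ≡⟨ cong (c *_) (sumℤ≡sum g) ⟨
  c * sumℤ g             ∎
  where open ≡-Reasoning

sumℤ-distrib-- : ∀ {m} (g h : Fin m → ℤ) → sumℤ (λ t → g t - h t) ≡ sumℤ g - sumℤ h
sumℤ-distrib-- g h = begin
  sumℤ (λ t → g t - h t)            ≡⟨ sumℤ-distrib-+ g (λ t → - h t) ⟩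
  sumℤ g + sumℤ (λ t → - h t)       ≡⟨ cong (λ x → sumℤ g + x) (sumℤ-cong (λ t → ℤₚ.-1*i≡-i (h t))) ⟨
  sumℤ g + sumℤ (λ t → ℤ.-1ℤ * h t) ≡⟨ cong (λ x → sumℤ g + x) (sumℤ-distribˡ-* ℤ.-1ℤ h) ⟩
  sumℤ g + ℤ.-1ℤ * sumℤ h           ≡⟨ cong (λ x → sumℤ g + x) (ℤₚ.-1*i≡-i (sumℤ h)) ⟩
  sumℤ g - sumℤ h                   ∎
  where open ≡-Reasoning

sumℤ-comm : ∀ {m n} (g : Fin m → Fin n → ℤ) →
            sumℤ (λ a → sumℤ (g a)) ≡ sumℤ (λ b → sumℤ (λ a → g a b))
sumℤ-comm g = begin
  sumℤ (λ a → sumℤ (g a))                 ≡⟨ sumℤ≡sum (λ a → sumℤ (g a)) ⟩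
  ΣZ.sum (λ a → sumℤ (g a))               ≡⟨ ΣZ.sum-cong-≗ (λ a → sumℤ≡sum (g a)) ⟩
  ΣZ.sum (λ a → ΣZ.sum (g a))             ≡⟨ ΣZ.∑-comm g ⟩
  ΣZ.sum (λ b → ΣZ.sum (λ a → g a b))     ≡⟨ ΣZ.sum-cong-≗ (λ b → sumℤ≡sum (λ a → g a b)) ⟨
  ΣZ.sum (λ b → sumℤ (λ a → g a b))       ≡⟨ sumℤ≡sum (λ b → sumℤ (λ a → g a b)) ⟨
  sumℤ (λ b → sumℤ (λ a → g a b))         ∎
  where open ≡-Reasoning

sumℤ-permute : ∀ {m} (g : Fin m → ℤ) (π : Permutation′ m) → sumℤ (λ t → g (π ⟨$⟩ʳ t)) ≡ sumℤ g
sumℤ-permute g π = begin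
  sumℤ (λ t → g (π ⟨$⟩ʳ t)) ≡⟨ sumℤ≡sum (λ t → g (π ⟨$⟩ʳ t)) ⟩
  ΣZ.sum (λ t → g (π ⟨$⟩ʳ t)) ≡⟨ ΣZ.sum-permute g π ⟨
  ΣZ.sum g                  ≡⟨ sumℤ≡sum g ⟨
  sumℤ g                    ∎
  where open ≡-Reasoning

sumℤ-supported-at : ∀ {m} (g : Fin m → ℤ) (j : Fin m) → (∀ t → t ≢ j → g t ≡ +0) → sumℤ g ≡ g j
sumℤ-supported-at {suc m} g zero g≡0 = begin
  g zero + sumℤ (g ∘ suc)           ≡⟨ cong (_+_ (g zero)) (sumℤ-cong (λ t → g≡0 (suc t) λ ())) ⟩
  g zero + sumℤ {m} (λ _ → +0)      ≡⟨ cong (_+_ (g zero)) (sumℤ-distribˡ-* {m} +0 (λ _ → +0)) ⟩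
  g zero + +0                       ≡⟨ ℤₚ.+-identityʳ _ ⟩
  g zero                            ∎
  where open ≡-Reasoning
sumℤ-supported-at g (suc j) g≡0 = begin
  g zero + sumℤ (g ∘ suc)  ≡⟨ cong (_+ sumℤ (g ∘ suc)) (g≡0 zero λ ()) ⟩
  +0 + sumℤ (g ∘ suc)      ≡⟨ ℤₚ.+-identityˡ _ ⟩
  sumℤ (g ∘ suc)
    ≡⟨ sumℤ-supported-at (g ∘ suc) j (λ t t≢j → g≡0 (suc t) (t≢j ∘ Finₚ.suc-injective)) ⟩
  g (suc j)                ∎
  where open ≡-Reasoning

sumℤ-nonPos : ∀ {m} (g : Fin m → ℤ) → (∀ t → g t ℤ.≤ +0) → sumℤ g ℤ.≤ +0
sumℤ-nonPos {zero}  g g≤0 = ℤₚ.≤-refl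
sumℤ-nonPos {suc m} g g≤0 = ℤₚ.+-mono-≤ (g≤0 zero) (sumℤ-nonPos (g ∘ suc) (g≤0 ∘ suc))

nonPos-sum-zero : ∀ {a b} → a ℤ.≤ +0 → b ℤ.≤ +0 → a + b ≡ +0 → a ≡ +0 × b ≡ +0
nonPos-sum-zero {a} {b} a≤0 b≤0 a+b≡0 = a≡0 , b≡0
  where
  open ℤₚ.≤-Reasoning
  a≡0 : a ≡ +0
  a≡0 = ℤₚ.≤-antisym a≤0 (begin
    +0     ≡⟨ a+b≡0 ⟨
    a + b  ≤⟨ ℤₚ.+-monoʳ-≤ a b≤0 ⟩
    a + +0 ≡⟨ ℤₚ.+-identityʳ a ⟩
    a      ∎)
  b≡0 : b ≡ +0
  b≡0 = ℤₚ.≤-antisym b≤0 (begin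
    +0     ≡⟨ a+b≡0 ⟨
    a + b  ≤⟨ ℤₚ.+-monoˡ-≤ b a≤0 ⟩
    +0 + b ≡⟨ ℤₚ.+-identityˡ b ⟩
    b      ∎)

sumℤ-nonPos-zero : ∀ {m} (g : Fin m → ℤ) → (∀ t → g t ℤ.≤ +0) → sumℤ g ≡ +0 → ∀ t → g t ≡ +0
sumℤ-nonPos-zero g g≤0 Σg≡0 zero =
  proj₁ (nonPos-sum-zero (g≤0 zero) (sumℤ-nonPos (g ∘ suc) (g≤0 ∘ suc)) Σg≡0)
sumℤ-nonPos-zero g g≤0 Σg≡0 (suc t) = sumℤ-nonPos-zero (g ∘ suc) (g≤0 ∘ suc)
  (proj₂ (nonPos-sum-zero (g≤0 zero) (sumℤ-nonPos (g ∘ suc) (g≤0 ∘ suc)) Σg≡0)) t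

-- The root lattice and the action of words

Q : ℕ → Set
Q m = Fin m → ℤ

α : ∀ {m} → Fin m → Q m
α k t = if does (t ≟ k) then + 1 else +0

α-self : ∀ {m} (k : Fin m) → α k k ≡ + 1
α-self k with k ≟ k
... | yes _   = refl
... | no k≢k = ⊥-elim (k≢k refl)

α-other : ∀ {m} {k t : Fin m} → t ≢ k → α k t ≡ +0
α-other {k = k} {t} t≢k with t ≟ k
... | yes t≡k = ⊥-elim (t≢k t≡k)
... | no _    = refl

α-nonNeg : ∀ {m} (k t : Fin m) → +0 ℤ.≤ α k t
α-nonNeg k t with t ≟ k
... | yes _ = ℤ.+≤+ z≤n
... | no _  = ℤ.+≤+ z≤n

NonNeg NonPos : ∀ {m} → Q m → Set
NonNeg μ = ∀ t → +0 ℤ.≤ μ t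
NonPos μ = ∀ t → μ t ℤ.≤ +0

pairing : ∀ {m} → Matrix m → Fin m → Q m → ℤ
pairing C k μ = sumℤ (λ j → C k j * μ j)

module _ {m : ℕ} (C : Matrix m) where

  sref-α : ∀ k μ t → sref C k μ t ≡ μ t - pairing C k μ * α k t
  sref-α k μ t with t ≟ k
  ... | yes _ = cong (_-_ (μ t)) (sym (ℤₚ.*-identityʳ _))
  ... | no _  = sym (begin
    μ t - pairing C k μ * +0 ≡⟨ cong (_-_ (μ t)) (ℤₚ.*-zeroʳ (pairing C k μ)) ⟩
    μ t - +0                 ≡⟨ ℤₚ.+-identityʳ (μ t) ⟩
    μ t                      ∎)
    where open ≡-Reasoning

  sref-self : ∀ k μ → sref C k μ k ≡ μ k - pairing C k μ
  sref-self k μ with k ≟ k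
  ... | yes _  = refl
  ... | no k≢k = ⊥-elim (k≢k refl)

  sref-other : ∀ {k t} μ → t ≢ k → sref C k μ t ≡ μ t
  sref-other {k} {t} μ t≢k with t ≟ k
  ... | yes t≡k = ⊥-elim (t≢k t≡k)
  ... | no _    = refl

  pairing-cong : ∀ k {μ ν} → μ ≗ ν → pairing C k μ ≡ pairing C k ν
  pairing-cong k μ≗ν = sumℤ-cong (λ j → cong (C k j *_) (μ≗ν j))

  pairing-α : ∀ k j → pairing C k (α j) ≡ C k j
  pairing-α k j = begin
    sumℤ (λ t → C k t * α j t)
      ≡⟨ sumℤ-supported-at _ j (λ t t≢j → trans (cong (C k t *_) (α-other t≢j)) (ℤₚ.*-zeroʳ (C k t))) ⟩
    C k j * α j j              ≡⟨ cong (C k j *_) (α-self j) ⟩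
    C k j * + 1                ≡⟨ ℤₚ.*-identityʳ (C k j) ⟩
    C k j                      ∎
    where open ≡-Reasoning

  pairing-+ : ∀ k μ ν → pairing C k (λ t → μ t + ν t) ≡ pairing C k μ + pairing C k ν
  pairing-+ k μ ν = trans (sumℤ-cong (λ j → ℤₚ.*-distribˡ-+ (C k j) (μ j) (ν j)))
                          (sumℤ-distrib-+ (λ j → C k j * μ j) (λ j → C k j * ν j))

  pairing-* : ∀ k c μ → pairing C k (λ t → c * μ t) ≡ c * pairing C k μ
  pairing-* k c μ = trans (sumℤ-cong (λ j → swap (C k j) c (μ j)))
                          (sumℤ-distribˡ-* c (λ j → C k j * μ j))
    where
    swap : ∀ x y z → x * (y * z) ≡ y * (x * z)
    swap = solve-∀

  pairing-sref : ∀ j k μ → pairing C j (sref C k μ) ≡ pairing C j μ - pairing C k μ * C j k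
  pairing-sref j k μ = begin
    pairing C j (sref C k μ)                                 ≡⟨ pairing-cong j (sref-α k μ) ⟩
    sumℤ (λ t → C j t * (μ t - p * α k t))                   ≡⟨ sumℤ-cong (λ t → distrib (C j t) (μ t) (p * α k t)) ⟩
    sumℤ (λ t → C j t * μ t - C j t * (p * α k t))           ≡⟨ sumℤ-distrib-- _ (λ t → C j t * (p * α k t)) ⟩
    pairing C j μ - sumℤ (λ t → C j t * (p * α k t))         ≡⟨ cong (_-_ (pairing C j μ)) (pairing-* j p (α k)) ⟩
    pairing C j μ - p * pairing C j (α k)                    ≡⟨ cong (λ x → pairing C j μ - p * x) (pairing-α j k) ⟩
    pairing C j μ - p * C j k                                ∎
    where
    open ≡-Reasoning
    p = pairing C k μ
    distrib : ∀ a b c → a * (b - c) ≡ a * b - a * c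
    distrib = solve-∀

  sref-cong : ∀ k {μ ν} → μ ≗ ν → sref C k μ ≗ sref C k ν
  sref-cong k {μ} {ν} μ≗ν t = begin
    sref C k μ t                     ≡⟨ sref-α k μ t ⟩
    μ t - pairing C k μ * α k t      ≡⟨ cong₂ (λ x y → x - y * α k t) (μ≗ν t) (pairing-cong k μ≗ν) ⟩
    ν t - pairing C k ν * α k t      ≡⟨ sref-α k ν t ⟨
    sref C k ν t                     ∎
    where open ≡-Reasoning

  act-cong : ∀ w {μ ν} → μ ≗ ν → act C w μ ≗ act C w ν
  act-cong []      μ≗ν = μ≗ν
  act-cong (k ∷ w) μ≗ν = sref-cong k (act-cong w μ≗ν)

  act-++ : ∀ u w μ → act C (u ++ w) μ ≡ act C u (act C w μ)
  act-++ u w μ = foldr-++ (sref C) μ u w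

  act-reverse-∷ : ∀ k w μ → act C (reverse (k ∷ w)) μ ≡ act C (reverse w) (sref C k μ)
  act-reverse-∷ k w μ = trans (reverse-foldr (sref C) μ (k ∷ w)) (sym (reverse-foldr (sref C) (sref C k μ) w))

  sref-+ : ∀ k μ ν → sref C k (λ t → μ t + ν t) ≗ (λ t → sref C k μ t + sref C k ν t)
  sref-+ k μ ν t = begin
    sref C k (λ t → μ t + ν t) t                               ≡⟨ sref-α k (λ t → μ t + ν t) t ⟩
    μ t + ν t - pairing C k (λ t → μ t + ν t) * α k t
      ≡⟨ cong (λ x → μ t + ν t - x * α k t) (pairing-+ k μ ν) ⟩
    μ t + ν t - (pairing C k μ + pairing C k ν) * α k t
      ≡⟨ regroup (μ t) (ν t) (pairing C k μ) (pairing C k ν) (α k t) ⟩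
    (μ t - pairing C k μ * α k t) + (ν t - pairing C k ν * α k t) ≡⟨ cong₂ _+_ (sref-α k μ t) (sref-α k ν t) ⟨
    sref C k μ t + sref C k ν t                                ∎
    where
    open ≡-Reasoning
    regroup : ∀ a b c d x → a + b - (c + d) * x ≡ (a - c * x) + (b - d * x)
    regroup = solve-∀

  sref-* : ∀ k c μ → sref C k (λ t → c * μ t) ≗ (λ t → c * sref C k μ t)
  sref-* k c μ t = begin
    sref C k (λ t → c * μ t) t                     ≡⟨ sref-α k (λ t → c * μ t) t ⟩
    c * μ t - pairing C k (λ t → c * μ t) * α k t  ≡⟨ cong (λ x → c * μ t - x * α k t) (pairing-* k c μ) ⟩
    c * μ t - c * pairing C k μ * α k t            ≡⟨ factor c (μ t) (pairing C k μ) (α k t) ⟩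
    c * (μ t - pairing C k μ * α k t)              ≡⟨ cong (c *_) (sref-α k μ t) ⟨
    c * sref C k μ t                               ∎
    where
    open ≡-Reasoning
    factor : ∀ c a p x → c * a - c * p * x ≡ c * (a - p * x)
    factor = solve-∀

  act-+ : ∀ w μ ν → act C w (λ t → μ t + ν t) ≗ (λ t → act C w μ t + act C w ν t)
  act-+ []      μ ν t = refl
  act-+ (k ∷ w) μ ν t =
    trans (sref-cong k (act-+ w μ ν) t) (sref-+ k (act C w μ) (act C w ν) t)

  act-* : ∀ w c μ → act C w (λ t → c * μ t) ≗ (λ t → c * act C w μ t)
  act-* []      c μ t = refl
  act-* (k ∷ w) c μ t = trans (sref-cong k (act-* w c μ) t) (sref-* k c (act C w μ) t)

  act-zero : ∀ w → act C w (λ _ → +0) ≗ (λ _ → +0)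
  act-zero w = act-* w +0 (λ _ → +0)

  act-sum : ∀ {n} w (μ : Fin n → Q m) →
            act C w (λ t → sumℤ (λ s → μ s t)) ≗ (λ t → sumℤ (λ s → act C w (μ s) t))
  act-sum {zero}  w μ t = act-zero w t
  act-sum {suc n} w μ t = trans (act-+ w (μ zero) (λ t → sumℤ (λ s → μ (suc s) t)) t)
                                (cong (_+_ (act C w (μ zero) t)) (act-sum w (μ ∘ suc) t))

  α-expansion : ∀ (μ : Q m) → μ ≗ (λ t → sumℤ (λ s → μ s * α s t))
  α-expansion μ t = sym (begin
    sumℤ (λ s → μ s * α s t)
      ≡⟨ sumℤ-supported-at _ t (λ s s≢t → trans (cong (μ s *_) (α-other (s≢t ∘ sym))) (ℤₚ.*-zeroʳ (μ s))) ⟩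
    μ t * α t t              ≡⟨ cong (μ t *_) (α-self t) ⟩
    μ t * + 1                ≡⟨ ℤₚ.*-identityʳ (μ t) ⟩
    μ t                      ∎)
    where open ≡-Reasoning

  act-α-expansion : ∀ w μ → act C w μ ≗ (λ t → sumℤ (λ s → μ s * act C w (α s) t))
  act-α-expansion w μ t = begin
    act C w μ t                                    ≡⟨ act-cong w (α-expansion μ) t ⟩
    act C w (λ t → sumℤ (λ s → μ s * α s t)) t     ≡⟨ act-sum w (λ s t → μ s * α s t) t ⟩
    sumℤ (λ s → act C w (λ t → μ s * α s t) t)     ≡⟨ sumℤ-cong (λ s → act-* w (μ s) (α s) t) ⟩
    sumℤ (λ s → μ s * act C w (α s) t)             ∎
    where open ≡-Reasoning

-- Weyl group and length

least-witness : (P : ℕ → Set) → (∀ n → Dec (P n)) → ∀ {N} → P N →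
                Σ ℕ λ n → P n × (∀ k → P k → n ℕ.≤ k)
least-witness P P? {N} pN = search N 0 (λ _ ()) (subst P (sym (ℕₚ.+-identityʳ N)) pN)
  where
  search : ∀ d i → (∀ k → k ℕ.< i → ¬ P k) → P (d ℕ.+ i) → Σ ℕ λ n → P n × (∀ k → P k → n ℕ.≤ k)
  search d i none-below _ with P? i
  ... | yes pi = i , pi , λ k pk → ℕₚ.≮⇒≥ (λ k<i → none-below k k<i pk)
  search zero    i none-below pd | no ¬pi = ⊥-elim (¬pi pd)
  search (suc d) i none-below pd | no ¬pi =
    search d (suc i) none-up-to-i (subst P (sym (ℕₚ.+-suc d i)) pd)
    where
    none-up-to-i : ∀ k → k ℕ.< suc i → ¬ P k
    none-up-to-i k k<1+i with ℕₚ.m≤n⇒m<n∨m≡n (ℕₚ.≤-pred k<1+i)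
    ... | inj₁ k<i  = none-below k k<i
    ... | inj₂ refl = ¬pi

module WeylGroup {m : ℕ} (C : Matrix m) (C-diag : ∀ k → C k k ≡ + 2) where

  sref-involutive : ∀ k μ → sref C k (sref C k μ) ≗ μ
  sref-involutive k μ t = begin
    sref C k (sref C k μ) t                      ≡⟨ sref-α C k (sref C k μ) t ⟩
    sref C k μ t - pairing C k (sref C k μ) * α k t
      ≡⟨ cong₂ (λ x y → x - y * α k t) (sref-α C k μ t) (pairing-sref C k k μ) ⟩
    μ t - p * α k t - (p - p * C k k) * α k t    ≡⟨ cong (λ c → μ t - p * α k t - (p - p * c) * α k t) (C-diag k) ⟩
    μ t - p * α k t - (p - p * + 2) * α k t      ≡⟨ cancel (μ t) p (α k t) ⟩
    μ t                                          ∎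
    where
    open ≡-Reasoning
    p = pairing C k μ
    cancel : ∀ a p x → a - p * x - (p - p * + 2) * x ≡ a
    cancel = solve-∀

  act-reverse-inverse : ∀ w μ → act C (reverse w) (act C w μ) ≗ μ
  act-reverse-inverse []      μ t = refl
  act-reverse-inverse (k ∷ w) μ t = begin
    act C (reverse (k ∷ w)) (sref C k (act C w μ)) t      ≡⟨ cong (λ ν → ν t) (act-reverse-∷ C k w _) ⟩
    act C (reverse w) (sref C k (sref C k (act C w μ))) t
      ≡⟨ act-cong C (reverse w) (sref-involutive k (act C w μ)) t ⟩
    act C (reverse w) (act C w μ) t                       ≡⟨ act-reverse-inverse w μ t ⟩
    μ t                                                   ∎
    where open ≡-Reasoning

  act-inverse-reverse : ∀ w μ → act C w (act C (reverse w) μ) ≗ μ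
  act-inverse-reverse w μ t =
    trans (cong (λ u → act C u (act C (reverse w) μ) t) (sym (reverse-involutive w)))
          (act-reverse-inverse (reverse w) μ t)

  infix 4 _≈_
  record _≈_ (u w : Word m) : Set where
    constructor ⟨_⟩
    field act-≗ : u ≈[ C ] w
  open _≈_ public

  ≈-refl : ∀ {w} → w ≈ w
  ≈-refl = ⟨ (λ _ _ → refl) ⟩

  ≈-sym : ∀ {u w} → u ≈ w → w ≈ u
  ≈-sym u≈w = ⟨ (λ μ t → sym (act-≗ u≈w μ t)) ⟩

  ≈-trans : ∀ {u v w} → u ≈ v → v ≈ w → u ≈ w
  ≈-trans u≈v v≈w = ⟨ (λ μ t → trans (act-≗ u≈v μ t) (act-≗ v≈w μ t)) ⟩

  ≈-setoid : Setoid _ _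
  ≈-setoid = record
    { Carrier = Word m ; _≈_ = _≈_
    ; isEquivalence = record { refl = ≈-refl ; sym = ≈-sym ; trans = ≈-trans } }

  module ≈-Reasoning = SetoidReasoning ≈-setoid

  ≈-++ : ∀ {u u' w w'} → u ≈ u' → w ≈ w' → u ++ w ≈ u' ++ w'
  ≈-++ {u} {u'} {w} {w'} u≈u' w≈w' = ⟨ (λ μ t → begin
    act C (u ++ w) μ t         ≡⟨ cong (λ ν → ν t) (act-++ C u w μ) ⟩
    act C u (act C w μ) t      ≡⟨ act-cong C u (act-≗ w≈w' μ) t ⟩
    act C u (act C w' μ) t     ≡⟨ act-≗ u≈u' (act C w' μ) t ⟩
    act C u' (act C w' μ) t    ≡⟨ cong (λ ν → ν t) (act-++ C u' w' μ) ⟨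
    act C (u' ++ w') μ t       ∎) ⟩
    where open ≡-Reasoning

  ≈-∷ : ∀ k {u w} → u ≈ w → k ∷ u ≈ k ∷ w
  ≈-∷ k = ≈-++ {[ k ]} ≈-refl

  ≈-reverse : ∀ {u w} → u ≈ w → reverse u ≈ reverse w
  ≈-reverse {u} {w} u≈w = ⟨ (λ μ t → begin
    act C (reverse u) μ t
      ≡⟨ act-cong C (reverse u) (λ t → sym (act-inverse-reverse w μ t)) t ⟩
    act C (reverse u) (act C w (act C (reverse w) μ)) t      ≡⟨ act-cong C (reverse u) (λ t → sym (act-≗ u≈w _ t)) t ⟩
    act C (reverse u) (act C u (act C (reverse w) μ)) t      ≡⟨ act-reverse-inverse u _ t ⟩
    act C (reverse w) μ t                                    ∎) ⟩
    where open ≡-Reasoning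

  sref-square : ∀ k → k ∷ k ∷ [] ≈ []
  sref-square k = ⟨ sref-involutive k ⟩

  ++-sref-square : ∀ w k → (w ++ [ k ]) ++ [ k ] ≈ w
  ++-sref-square w k = begin
    (w ++ [ k ]) ++ [ k ]  ≡⟨ ++-assoc w [ k ] [ k ] ⟩
    w ++ k ∷ k ∷ []        ≈⟨ ≈-++ (≈-refl {w}) (sref-square k) ⟩
    w ++ []                ≡⟨ ++-identityʳ w ⟩
    w                      ∎
    where open ≈-Reasoning

  sref-negates-α : ∀ k → sref C k (α k) ≗ (λ t → ℤ.-1ℤ * α k t)
  sref-negates-α k t = begin
    sref C k (α k) t                        ≡⟨ sref-α C k (α k) t ⟩
    α k t - pairing C k (α k) * α k t       ≡⟨ cong (λ c → α k t - c * α k t) (trans (pairing-α C k k) (C-diag k)) ⟩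
    α k t - + 2 * α k t                     ≡⟨ negate (α k t) ⟩
    ℤ.-1ℤ * α k t                           ∎
    where
    open ≡-Reasoning
    negate : ∀ a → a - + 2 * a ≡ ℤ.-1ℤ * a
    negate = solve-∀

  act-snoc-α : ∀ w k → act C (w ++ [ k ]) (α k) ≗ (λ t → - act C w (α k) t)
  act-snoc-α w k t = begin
    act C (w ++ [ k ]) (α k) t          ≡⟨ cong (λ ν → ν t) (foldr-∷ʳ (sref C) (α k) k w) ⟩
    act C w (sref C k (α k)) t          ≡⟨ act-cong C w (sref-negates-α k) t ⟩
    act C w (λ t → ℤ.-1ℤ * α k t) t     ≡⟨ act-* C w ℤ.-1ℤ (α k) t ⟩
    ℤ.-1ℤ * act C w (α k) t             ≡⟨ ℤₚ.-1*i≡-i _ ⟩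
    - act C w (α k) t                   ∎
    where open ≡-Reasoning

  act-α-nonzero : ∀ w k → ¬ (act C w (α k) ≗ (λ _ → +0))
  act-α-nonzero w k wα≡0 = 1≢0 (begin
    + 1                                  ≡⟨ α-self k ⟨
    α k k                                ≡⟨ act-reverse-inverse w (α k) k ⟨
    act C (reverse w) (act C w (α k)) k  ≡⟨ act-cong C (reverse w) wα≡0 k ⟩
    act C (reverse w) (λ _ → +0) k       ≡⟨ act-zero C (reverse w) k ⟩
    +0                                   ∎)
    where
    open ≡-Reasoning
    1≢0 : + 1 ≢ +0
    1≢0 ()

  ≈-on-α : ∀ {u w} → (∀ s → act C u (α s) ≗ act C w (α s)) → u ≈ w
  ≈-on-α {u} {w} agree = ⟨ (λ μ t → begin
    act C u μ t                             ≡⟨ act-α-expansion C u μ t ⟩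
    sumℤ (λ s → μ s * act C u (α s) t)      ≡⟨ sumℤ-cong (λ s → cong (μ s *_) (agree s t)) ⟩
    sumℤ (λ s → μ s * act C w (α s) t)      ≡⟨ act-α-expansion C w μ t ⟨
    act C w μ t                             ∎) ⟩
    where open ≡-Reasoning

  _≈?_ : ∀ u w → Dec (u ≈ w)
  u ≈? w = map′ ≈-on-α (λ u≈w s → act-≗ u≈w (α s))
                (Finₚ.all? λ s → Finₚ.all? λ t → act C u (α s) t ℤ.≟ act C w (α s) t)

  word-of-length? : ∀ n (P : Word m → Set) → (∀ u → Dec (P u)) →
                    Dec (Σ (Word m) λ u → length u ≡ n × P u)
  word-of-length? zero P P? with P? []
  ... | yes p  = yes ([] , refl , p)
  ... | no ¬p  = no λ { ([] , _ , p) → ¬p p }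
  word-of-length? (suc n) P P? with Finₚ.any? (λ k → word-of-length? n (P ∘ (k ∷_)) (P? ∘ (k ∷_)))
  ... | yes (k , u , |u|≡n , p) = yes (k ∷ u , cong suc |u|≡n , p)
  ... | no ¬p = no λ { (k ∷ u , |u|≡n , p) → ¬p (k , u , ℕₚ.suc-injective |u|≡n , p) }

  abstract
    length-exists : ∀ w → Σ ℕ (HasLength C w)
    length-exists w with least-witness (λ n → Σ (Word m) λ u → length u ≡ n × u ≈ w)
                                       (λ n → word-of-length? n (_≈ w) (_≈? w))
                                       (w , refl , ≈-refl)
    ... | n , (u , |u|≡n , u≈w) , least =
      n , (u , |u|≡n , act-≗ u≈w) , λ u' u'≈w → least (length u') (u' , refl , ⟨ u'≈w ⟩)

  ℓ : Word m → ℕ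
  ℓ w = proj₁ (length-exists w)

  ℓ-hasLength : ∀ w → HasLength C w (ℓ w)
  ℓ-hasLength w = proj₂ (length-exists w)

  ℓ-≤-length : ∀ {u w} → u ≈ w → ℓ w ℕ.≤ length u
  ℓ-≤-length {u} u≈w = proj₂ (ℓ-hasLength _) u (act-≗ u≈w)

  ℓ-≤-length-self : ∀ w → ℓ w ℕ.≤ length w
  ℓ-≤-length-self w = ℓ-≤-length (≈-refl {w})

  reduced-word : ∀ w → Σ (Word m) λ u → length u ≡ ℓ w × u ≈ w
  reduced-word w with proj₁ (ℓ-hasLength w)
  ... | u , |u|≡ℓw , u≈w = u , |u|≡ℓw , ⟨ u≈w ⟩

  hasLength⇒≡ℓ : ∀ {w l} → HasLength C w l → ℓ w ≡ l
  hasLength⇒≡ℓ {w} {l} ((u , |u|≡l , u≈w) , l-least) with reduced-word w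
  ... | u' , |u'|≡ℓw , u'≈w = ℕₚ.≤-antisym
    (subst (ℓ w ℕ.≤_) |u|≡l (ℓ-≤-length {u} ⟨ u≈w ⟩))
    (subst (l ℕ.≤_) |u'|≡ℓw (l-least u' (act-≗ u'≈w)))

  ℓ-cong : ∀ {u w} → u ≈ w → ℓ u ≡ ℓ w
  ℓ-cong u≈w = ℕₚ.≤-antisym (ℓ-≥ (≈-sym u≈w)) (ℓ-≥ u≈w)
    where
    ℓ-≥ : ∀ {u w} → u ≈ w → ℓ w ℕ.≤ ℓ u
    ℓ-≥ {u} u≈w with reduced-word u
    ... | u' , |u'|≡ℓu , u'≈u = subst (_ ℕ.≤_) |u'|≡ℓu (ℓ-≤-length (≈-trans u'≈u u≈w))

  ℓ-reverse-≤ : ∀ w → ℓ (reverse w) ℕ.≤ ℓ w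
  ℓ-reverse-≤ w with reduced-word w
  ... | u , |u|≡ℓw , u≈w =
    subst (_ ℕ.≤_) (trans (length-reverse u) |u|≡ℓw) (ℓ-≤-length (≈-reverse u≈w))

  ℓ-reverse : ∀ w → ℓ (reverse w) ≡ ℓ w
  ℓ-reverse w = ℕₚ.≤-antisym (ℓ-reverse-≤ w)
    (subst (λ u → ℓ u ℕ.≤ ℓ (reverse w)) (reverse-involutive w) (ℓ-reverse-≤ (reverse w)))

  ℓ-++ : ∀ u w → ℓ (u ++ w) ℕ.≤ ℓ u ℕ.+ ℓ w
  ℓ-++ u w with reduced-word u | reduced-word w
  ... | u' , |u'|≡ℓu , u'≈u | w' , |w'|≡ℓw , w'≈w =
    subst (_ ℕ.≤_) (trans (length-++ u') (cong₂ ℕ._+_ |u'|≡ℓu |w'|≡ℓw)) (ℓ-≤-length (≈-++ u'≈u w'≈w))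

  ℓ-++-≤ : ∀ {u w} v → u ≈ v ++ w → ℓ u ℕ.≤ ℓ v ℕ.+ length w
  ℓ-++-≤ {u} {w} v u≈vw = begin
    ℓ u              ≡⟨ ℓ-cong u≈vw ⟩
    ℓ (v ++ w)       ≤⟨ ℓ-++ v w ⟩
    ℓ v ℕ.+ ℓ w      ≤⟨ ℕₚ.+-monoʳ-≤ (ℓ v) (ℓ-≤-length-self w) ⟩
    ℓ v ℕ.+ length w ∎
    where open ℕₚ.≤-Reasoning

  ℓ-snoc : ∀ w k → ℓ (w ++ [ k ]) ℕ.≤ suc (ℓ w)
  ℓ-snoc w k = subst (ℓ (w ++ [ k ]) ℕ.≤_) (ℕₚ.+-comm (ℓ w) 1) (ℓ-++-≤ {w = [ k ]} w ≈-refl)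

-- Rank two

flips : ℕ → Bool → Bool
flips zero    b = b
flips (suc n) b = not (flips n b)

alternating : Bool → ℕ → List Bool
alternating b zero    = []
alternating b (suc n) = flips n b ∷ alternating b n

length-alternating : ∀ b n → length (alternating b n) ≡ n
length-alternating b zero    = refl
length-alternating b (suc n) = cong suc (length-alternating b n)

alternating-+ : ∀ b d n → Σ (List Bool) λ q → length q ≡ d × alternating b (d ℕ.+ n) ≡ q ++ alternating b n
alternating-+ b zero    n = [] , refl , refl
alternating-+ b (suc d) n with alternating-+ b d n
... | q , |q|≡d , eq = flips (d ℕ.+ n) b ∷ q , cong suc |q|≡d , cong (flips (d ℕ.+ n) b ∷_) eq

alternating-last : ∀ b n → Σ (List Bool) λ p → length p ≡ n × alternating b (suc n) ≡ p ++ [ b ]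
alternating-last b zero    = [] , refl , refl
alternating-last b (suc n) with alternating-last b n
... | p , |p|≡n , eq = flips (suc n) b ∷ p , cong suc |p|≡n , cong (flips (suc n) b ∷_) eq

-- Rank two data C s s' = c, C s' s = c'; true stands for s, false for s', and a pair (X , Y)
-- for X α_s + Y α_s'.

reflectCoeffs : ℤ → ℤ → Bool → ℤ × ℤ → ℤ × ℤ
reflectCoeffs c c' true  (X , Y) = - X - c * Y , Y
reflectCoeffs c c' false (X , Y) = X , - Y - c' * X

rootCoeffs : ℤ → ℤ → ℕ → ℤ × ℤ
rootCoeffs c c' zero    = + 1 , +0
rootCoeffs c c' (suc n) = reflectCoeffs c c' (flips n false) (rootCoeffs c c' n)

NonNegPair : ℤ × ℤ → Set
NonNegPair (X , Y) = +0 ℤ.≤ X × +0 ℤ.≤ Y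

NonNegPair? : ∀ XY → Dec (NonNegPair XY)
NonNegPair? (X , Y) = (+0 ℤₚ.≤? X) ×-dec (+0 ℤₚ.≤? Y)

-- A linear form (a , b) stands for μ ↦ a ⟨μ, α_s^∨⟩ + b ⟨μ, α_s'^∨⟩.
Form : Set
Form = ℤ × ℤ

_⊖_ : Form → Form → Form
(a , b) ⊖ (a' , b') = a - a' , b - b'

⊝_ : Form → Form
⊝ (a , b) = - a , - b

_⊛_ : ℤ → Form → Form
c ⊛ (a , b) = c * a , c * b

-- The action of a word in s, s' on μ is μ + (coeff at μ) α_s + (coeff' at μ) α_s',
-- and the result pairs with α_s^∨, α_s'^∨ to (pair at μ), (pair' at μ).
record Symbolic : Set where
  field
    coeff coeff' pair pair' : Form
open Symbolic

symbolic : ℤ → ℤ → List Bool → Symbolic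
symbolic c c' []      = record { coeff = +0 , +0 ; coeff' = +0 , +0 ; pair = + 1 , +0 ; pair' = +0 , + 1 }
symbolic c c' (true ∷ u) = let σ = symbolic c c' u in record σ
  { coeff = coeff σ ⊖ pair σ ; pair = ⊝ pair σ ; pair' = pair' σ ⊖ (c' ⊛ pair σ) }
symbolic c c' (false ∷ u) = let σ = symbolic c c' u in record σ
  { coeff' = coeff' σ ⊖ pair' σ ; pair = pair σ ⊖ (c ⊛ pair' σ) ; pair' = ⊝ pair' σ }

shift : Symbolic → Form × Form
shift σ = coeff σ , coeff' σ

record FiniteType (c c' : ℤ) (k : ℕ) : Set where
  field
    braid-relation : shift (symbolic c c' (alternating false k)) ≡ shift (symbolic c c' (alternating true k))
    coeffs-nonNeg  : ∀ {n} → n ℕ.< k → NonNegPair (rootCoeffs c c' n)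
open FiniteType

finiteType : ∀ {c c' k} →
             shift (symbolic c c' (alternating false k)) ≡ shift (symbolic c c' (alternating true k)) →
             {True (ℕₚ.allUpTo? (λ n → NonNegPair? (rootCoeffs c c' n)) k)} → FiniteType c c' k
finiteType braid {nonNeg} = record { braid-relation = braid ; coeffs-nonNeg = toWitness nonNeg }

type-A₁×A₁ : FiniteType +0 +0 2
type-A₁×A₁ = finiteType refl

type-A₂ : FiniteType -[1+ 0 ] -[1+ 0 ] 3
type-A₂ = finiteType refl

type-B₂ : FiniteType -[1+ 0 ] -[1+ 1 ] 4
type-B₂ = finiteType refl

type-B₂ᵀ : FiniteType -[1+ 1 ] -[1+ 0 ] 4
type-B₂ᵀ = finiteType refl

type-G₂ : FiniteType -[1+ 0 ] -[1+ 2 ] 6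
type-G₂ = finiteType refl

type-G₂ᵀ : FiniteType -[1+ 2 ] -[1+ 0 ] 6
type-G₂ᵀ = finiteType refl

-- The step of the invariant p Y ≤ 2 X that keeps all root coefficients nonnegative when
-- C s s' = - a, C s' s = - b and a b ≥ 4; it is used with (p , q) = (a , b) and (b , a) in turn.
reflect-nonNeg : ∀ p q {X Y} → 4 ℕ.≤ p ℕ.* q → +0 ℤ.≤ Y → + p * Y ℤ.≤ + 2 * X →
                 +0 ℤ.≤ - Y - (- + q) * X × + q * X ℤ.≤ + 2 * (- Y - (- + q) * X)
reflect-nonNeg p q {X} {Y} 4≤pq 0≤Y pY≤2X = 0≤Y' , qX≤2Y'
  where
  open ℤₚ.≤-Reasoning
  instance
    Y-nonNeg : ℤ.NonNegative Y
    Y-nonNeg = ℤ.nonNegative 0≤Y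
  2Y≤qX : + 2 * Y ℤ.≤ + q * X
  2Y≤qX = ℤₚ.*-cancelˡ-≤-pos (+ 2 * Y) (+ q * X) (+ 2) (begin
    + 2 * (+ 2 * Y)   ≡⟨ ℤₚ.*-assoc (+ 2) (+ 2) Y ⟨
    + 4 * Y           ≤⟨ ℤₚ.*-monoʳ-≤-nonNeg Y (ℤ.+≤+ 4≤pq) ⟩
    + (p ℕ.* q) * Y   ≡⟨ cong (_* Y) (ℤₚ.pos-* p q) ⟩
    + p * + q * Y     ≡⟨ swap (+ p) (+ q) Y ⟩
    + q * (+ p * Y)   ≤⟨ ℤₚ.*-monoˡ-≤-nonNeg (+ q) pY≤2X ⟩
    + q * (+ 2 * X)   ≡⟨ ℤₚ.*-assoc (+ q) (+ 2) X ⟨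
    + q * + 2 * X     ≡⟨ swap (+ q) (+ 2) X ⟩
    + 2 * (+ q * X)   ∎)
    where
    swap : ∀ a b c → a * b * c ≡ b * (a * c)
    swap = solve-∀
  Y′≡qX-Y : - Y - (- + q) * X ≡ + q * X - Y
  Y′≡qX-Y = rearrange Y (+ q) X
    where
    rearrange : ∀ y q x → - y - (- q) * x ≡ q * x - y
    rearrange = solve-∀
  0≤Y' : +0 ℤ.≤ - Y - (- + q) * X
  0≤Y' = subst (+0 ℤ.≤_) (sym Y′≡qX-Y) (ℤₚ.i≤j⇒0≤j-i (begin
    Y          ≤⟨ ℤₚ.i≤j⇒i≤k+j Y ℤₚ.≤-refl ⟩
    Y + Y      ≡⟨ double Y ⟩
    + 2 * Y    ≤⟨ 2Y≤qX ⟩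
    + q * X    ∎))
    where
    double : ∀ y → y + y ≡ + 2 * y
    double = solve-∀
  qX≤2Y' : + q * X ℤ.≤ + 2 * (- Y - (- + q) * X)
  qX≤2Y' = ℤₚ.0≤i-j⇒j≤i (subst (+0 ℤ.≤_) (difference (+ q) X Y)
             (ℤₚ.i≤j⇒0≤j-i 2Y≤qX))
    where
    difference : ∀ q x y → q * x - + 2 * y ≡ + 2 * (- y - (- q) * x) - q * x
    difference = solve-∀

module InfiniteType (a b : ℕ) (4≤ab : 4 ℕ.≤ a ℕ.* b) where

  Invariant : Bool → ℤ × ℤ → Set
  Invariant false (X , Y) = NonNegPair (X , Y) × + a * Y ℤ.≤ + 2 * X
  Invariant true  (X , Y) = NonNegPair (X , Y) × + b * X ℤ.≤ + 2 * Y

  invariant : ∀ n → Invariant (flips n false) (rootCoeffs (- + a) (- + b) n)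
  invariant zero = (ℤ.+≤+ z≤n , ℤ.+≤+ z≤n) , subst (ℤ._≤ + 2) (sym (ℤₚ.*-zeroʳ (+ a))) (ℤ.+≤+ z≤n)
  invariant (suc n) with flips n false | rootCoeffs (- + a) (- + b) n | invariant n
  ... | false | X , Y | (0≤X , 0≤Y) , aY≤2X =
    let 0≤Y' , bX≤2Y' = reflect-nonNeg a b 4≤ab 0≤Y aY≤2X in (0≤X , 0≤Y') , bX≤2Y'
  ... | true  | X , Y | (0≤X , 0≤Y) , bX≤2Y =
    let 0≤X' , aY≤2X' = reflect-nonNeg b a (subst (4 ℕ.≤_) (ℕₚ.*-comm a b) 4≤ab) 0≤X bX≤2Y
    in (0≤X' , 0≤Y) , aY≤2X'

  rootCoeffs-nonNeg : ∀ n → NonNegPair (rootCoeffs (- + a) (- + b) n)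
  rootCoeffs-nonNeg n with flips n false | invariant n
  ... | false | nonNeg , _ = nonNeg
  ... | true  | nonNeg , _ = nonNeg

module RankTwo {m : ℕ} (C : Matrix m) (C-diag : ∀ k → C k k ≡ + 2) (s s' : Fin m) where
  open WeylGroup C C-diag

  letter : Bool → Fin m
  letter true  = s
  letter false = s'

  word : List Bool → Word m
  word = map letter

  infix 9 _at_
  _at_ : Form → Q m → ℤ
  (a , b) at μ = a * pairing C s μ + b * pairing C s' μ

  at-⊖ : ∀ F G μ → (F ⊖ G) at μ ≡ F at μ - G at μ
  at-⊖ (a , b) (a' , b') μ = distrib a b a' b' (pairing C s μ) (pairing C s' μ)
    where
    distrib : ∀ a b a' b' x y → (a - a') * x + (b - b') * y ≡ a * x + b * y - (a' * x + b' * y)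
    distrib = solve-∀

  at-⊝ : ∀ F μ → (⊝ F) at μ ≡ - F at μ
  at-⊝ (a , b) μ = distrib a b (pairing C s μ) (pairing C s' μ)
    where
    distrib : ∀ a b x y → (- a) * x + (- b) * y ≡ - (a * x + b * y)
    distrib = solve-∀

  at-⊛ : ∀ c F μ → (c ⊛ F) at μ ≡ c * F at μ
  at-⊛ c (a , b) μ = distrib a b c (pairing C s μ) (pairing C s' μ)
    where
    distrib : ∀ a b c x y → c * a * x + c * b * y ≡ c * (a * x + b * y)
    distrib = solve-∀

  σ : List Bool → Symbolic
  σ = symbolic (C s s') (C s' s)

  Realises : Symbolic → List Bool → Set
  Realises τ u = ∀ μ →
    (∀ t → act C (word u) μ t ≡ μ t + coeff τ at μ * α s t + coeff' τ at μ * α s' t) ×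
    pairing C s  (act C (word u) μ) ≡ pair  τ at μ ×
    pairing C s' (act C (word u) μ) ≡ pair' τ at μ

  symbolic-sound : ∀ u → Realises (σ u) u
  symbolic-sound [] μ = (λ t → unchanged (μ t) x y (α s t) (α s' t)) , unit x y , unit′ x y
    where
    x = pairing C s μ
    y = pairing C s' μ
    unchanged : ∀ a x y d d' → a ≡ a + (+0 * x + +0 * y) * d + (+0 * x + +0 * y) * d'
    unchanged = solve-∀
    unit : ∀ x y → x ≡ + 1 * x + +0 * y
    unit = solve-∀
    unit′ : ∀ x y → y ≡ +0 * x + + 1 * y
    unit′ = solve-∀
  symbolic-sound (true ∷ u) μ = act-eq , pair-eq , pair'-eq
    where
    open ≡-Reasoning
    ν = act C (word u) μ
    P = coeff (σ u) at μ
    Q′ = coeff' (σ u) at μ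
    X = pair (σ u) at μ
    Y = pair' (σ u) at μ
    ν-act = proj₁ (symbolic-sound u μ)
    ν-pair = proj₁ (proj₂ (symbolic-sound u μ))
    ν-pair' = proj₂ (proj₂ (symbolic-sound u μ))
    act-eq : ∀ t → sref C s ν t ≡ μ t + (coeff (σ u) ⊖ pair (σ u)) at μ * α s t + Q′ * α s' t
    act-eq t = begin
      sref C s ν t                                  ≡⟨ sref-α C s ν t ⟩
      ν t - pairing C s ν * α s t                   ≡⟨ cong₂ (λ x y → x - y * α s t) (ν-act t) ν-pair ⟩
      μ t + P * α s t + Q′ * α s' t - X * α s t     ≡⟨ regroup (μ t) P Q′ X (α s t) (α s' t) ⟩
      μ t + (P - X) * α s t + Q′ * α s' t
        ≡⟨ cong (λ z → μ t + z * α s t + Q′ * α s' t) (at-⊖ (coeff (σ u)) (pair (σ u)) μ) ⟨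
      μ t + (coeff (σ u) ⊖ pair (σ u)) at μ * α s t + Q′ * α s' t ∎
      where
      regroup : ∀ a p q x d d' → a + p * d + q * d' - x * d ≡ a + (p - x) * d + q * d'
      regroup = solve-∀
    pair-eq : pairing C s (sref C s ν) ≡ (⊝ pair (σ u)) at μ
    pair-eq = begin
      pairing C s (sref C s ν)            ≡⟨ pairing-sref C s s ν ⟩
      pairing C s ν - pairing C s ν * C s s ≡⟨ cong₂ (λ x c → x - x * c) ν-pair (C-diag s) ⟩
      X - X * + 2                         ≡⟨ negate X ⟩
      - X                                 ≡⟨ at-⊝ (pair (σ u)) μ ⟨
      (⊝ pair (σ u)) at μ                 ∎
      where
      negate : ∀ x → x - x * + 2 ≡ - x
      negate = solve-∀
    pair'-eq : pairing C s' (sref C s ν) ≡ (pair' (σ u) ⊖ (C s' s ⊛ pair (σ u))) at μ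
    pair'-eq = begin
      pairing C s' (sref C s ν)              ≡⟨ pairing-sref C s' s ν ⟩
      pairing C s' ν - pairing C s ν * C s' s ≡⟨ cong₂ (λ y x → y - x * C s' s) ν-pair' ν-pair ⟩
      Y - X * C s' s                         ≡⟨ cong (_-_ Y) (ℤₚ.*-comm X (C s' s)) ⟩
      Y - C s' s * X                         ≡⟨ cong (_-_ Y) (at-⊛ (C s' s) (pair (σ u)) μ) ⟨
      Y - (C s' s ⊛ pair (σ u)) at μ         ≡⟨ at-⊖ (pair' (σ u)) (C s' s ⊛ pair (σ u)) μ ⟨
      (pair' (σ u) ⊖ (C s' s ⊛ pair (σ u))) at μ ∎
  symbolic-sound (false ∷ u) μ = act-eq , pair-eq , pair'-eq
    where
    open ≡-Reasoning
    ν = act C (word u) μ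
    P = coeff (σ u) at μ
    Q′ = coeff' (σ u) at μ
    X = pair (σ u) at μ
    Y = pair' (σ u) at μ
    ν-act = proj₁ (symbolic-sound u μ)
    ν-pair = proj₁ (proj₂ (symbolic-sound u μ))
    ν-pair' = proj₂ (proj₂ (symbolic-sound u μ))
    act-eq : ∀ t → sref C s' ν t ≡ μ t + P * α s t + (coeff' (σ u) ⊖ pair' (σ u)) at μ * α s' t
    act-eq t = begin
      sref C s' ν t                                 ≡⟨ sref-α C s' ν t ⟩
      ν t - pairing C s' ν * α s' t                 ≡⟨ cong₂ (λ x y → x - y * α s' t) (ν-act t) ν-pair' ⟩
      μ t + P * α s t + Q′ * α s' t - Y * α s' t    ≡⟨ regroup (μ t) P Q′ Y (α s t) (α s' t) ⟩
      μ t + P * α s t + (Q′ - Y) * α s' t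
        ≡⟨ cong (λ z → μ t + P * α s t + z * α s' t) (at-⊖ (coeff' (σ u)) (pair' (σ u)) μ) ⟨
      μ t + P * α s t + (coeff' (σ u) ⊖ pair' (σ u)) at μ * α s' t ∎
      where
      regroup : ∀ a p q y d d' → a + p * d + q * d' - y * d' ≡ a + p * d + (q - y) * d'
      regroup = solve-∀
    pair-eq : pairing C s (sref C s' ν) ≡ (pair (σ u) ⊖ (C s s' ⊛ pair' (σ u))) at μ
    pair-eq = begin
      pairing C s (sref C s' ν)               ≡⟨ pairing-sref C s s' ν ⟩
      pairing C s ν - pairing C s' ν * C s s' ≡⟨ cong₂ (λ x y → x - y * C s s') ν-pair ν-pair' ⟩
      X - Y * C s s'                          ≡⟨ cong (_-_ X) (ℤₚ.*-comm Y (C s s')) ⟩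
      X - C s s' * Y                          ≡⟨ cong (_-_ X) (at-⊛ (C s s') (pair' (σ u)) μ) ⟨
      X - (C s s' ⊛ pair' (σ u)) at μ         ≡⟨ at-⊖ (pair (σ u)) (C s s' ⊛ pair' (σ u)) μ ⟨
      (pair (σ u) ⊖ (C s s' ⊛ pair' (σ u))) at μ ∎
    pair'-eq : pairing C s' (sref C s' ν) ≡ (⊝ pair' (σ u)) at μ
    pair'-eq = begin
      pairing C s' (sref C s' ν)               ≡⟨ pairing-sref C s' s' ν ⟩
      pairing C s' ν - pairing C s' ν * C s' s' ≡⟨ cong₂ (λ y c → y - y * c) ν-pair' (C-diag s') ⟩
      Y - Y * + 2                              ≡⟨ negate Y ⟩
      - Y                                      ≡⟨ at-⊝ (pair' (σ u)) μ ⟨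
      (⊝ pair' (σ u)) at μ                     ∎
      where
      negate : ∀ x → x - x * + 2 ≡ - x
      negate = solve-∀

  braid : ∀ u u' → shift (σ u) ≡ shift (σ u') → word u ≈ word u'
  braid u u' same-shift = ⟨ (λ μ t → begin
    act C (word u) μ t                                                ≡⟨ proj₁ (symbolic-sound u μ) t ⟩
    μ t + coeff (σ u) at μ * α s t + coeff' (σ u) at μ * α s' t
      ≡⟨ cong (λ (F , F') → μ t + F at μ * α s t + F' at μ * α s' t) same-shift ⟩
    μ t + coeff (σ u') at μ * α s t + coeff' (σ u') at μ * α s' t     ≡⟨ proj₁ (symbolic-sound u' μ) t ⟨
    act C (word u') μ t                                               ∎) ⟩
    where open ≡-Reasoning

  span : ℤ × ℤ → Q m
  span (X , Y) t = X * α s t + Y * α s' t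

  pairing-span : ∀ k X Y → pairing C k (span (X , Y)) ≡ X * C k s + Y * C k s'
  pairing-span k X Y = trans (pairing-+ C k (λ t → X * α s t) (λ t → Y * α s' t))
    (cong₂ _+_ (trans (pairing-* C k X (α s))  (cong (X *_) (pairing-α C k s)))
               (trans (pairing-* C k Y (α s')) (cong (Y *_) (pairing-α C k s'))))

  sref-span : ∀ b XY → sref C (letter b) (span XY) ≗ span (reflectCoeffs (C s s') (C s' s) b XY)
  sref-span true (X , Y) t = begin
    sref C s (span (X , Y)) t                                     ≡⟨ sref-α C s (span (X , Y)) t ⟩
    span (X , Y) t - pairing C s (span (X , Y)) * α s t
      ≡⟨ cong (λ p → span (X , Y) t - p * α s t) (pairing-span s X Y) ⟩
    X * α s t + Y * α s' t - (X * C s s + Y * C s s') * α s t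
      ≡⟨ cong (λ c → X * α s t + Y * α s' t - (X * c + Y * C s s') * α s t) (C-diag s) ⟩
    X * α s t + Y * α s' t - (X * + 2 + Y * C s s') * α s t       ≡⟨ regroup X Y (C s s') (α s t) (α s' t) ⟩
    (- X - C s s' * Y) * α s t + Y * α s' t                       ∎
    where
    open ≡-Reasoning
    regroup : ∀ X Y c a b → X * a + Y * b - (X * + 2 + Y * c) * a ≡ (- X - c * Y) * a + Y * b
    regroup = solve-∀
  sref-span false (X , Y) t = begin
    sref C s' (span (X , Y)) t                                    ≡⟨ sref-α C s' (span (X , Y)) t ⟩
    span (X , Y) t - pairing C s' (span (X , Y)) * α s' t
      ≡⟨ cong (λ p → span (X , Y) t - p * α s' t) (pairing-span s' X Y) ⟩
    X * α s t + Y * α s' t - (X * C s' s + Y * C s' s') * α s' t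
      ≡⟨ cong (λ c → X * α s t + Y * α s' t - (X * C s' s + Y * c) * α s' t) (C-diag s') ⟩
    X * α s t + Y * α s' t - (X * C s' s + Y * + 2) * α s' t      ≡⟨ regroup X Y (C s' s) (α s t) (α s' t) ⟩
    X * α s t + (- Y - C s' s * X) * α s' t                       ∎
    where
    open ≡-Reasoning
    regroup : ∀ X Y c a b → X * a + Y * b - (X * c + Y * + 2) * b ≡ X * a + (- Y - c * X) * b
    regroup = solve-∀

  act-alternating-α : ∀ n → act C (word (alternating false n)) (α s) ≗ span (rootCoeffs (C s s') (C s' s) n)
  act-alternating-α zero    t = unit (α s t) (α s' t)
    where
    unit : ∀ a b → a ≡ + 1 * a + +0 * b
    unit = solve-∀
  act-alternating-α (suc n) t = trans (sref-cong C (letter (flips n false)) (act-alternating-α n) t)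
                                      (sref-span (flips n false) _ t)

  EndsWith-s : List Bool → Set
  EndsWith-s u = Σ (Word m) λ p → suc (length p) ≡ length u × word u ≈ p ++ [ s ]

  NonNegSpan : List Bool → Set
  NonNegSpan u = Σ (ℤ × ℤ) λ XY → NonNegPair XY × act C (word u) (α s) ≗ span XY

  Dichotomy : Set
  Dichotomy = ∀ n → EndsWith-s (alternating false n) ⊎ NonNegSpan (alternating false n)

  beyond-braid-ends-with-s : ∀ k → word (alternating false (suc k)) ≈ word (alternating true (suc k)) →
                             ∀ d → EndsWith-s (alternating false (d ℕ.+ suc k))
  beyond-braid-ends-with-s k braid-rel d with alternating-+ false d (suc k) | alternating-last true k
  ... | q , |q|≡d , split | p , |p|≡k , last = word q ++ word p , length-eq , word-eq
    where
    length-eq : suc (length (word q ++ word p)) ≡ length (alternating false (d ℕ.+ suc k))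
    length-eq = begin
      suc (length (word q ++ word p))              ≡⟨ cong suc (length-++ (word q)) ⟩
      suc (length (word q) ℕ.+ length (word p))
        ≡⟨ cong₂ (λ x y → suc (x ℕ.+ y)) (length-map letter q) (length-map letter p) ⟩
      suc (length q ℕ.+ length p)                  ≡⟨ cong₂ (λ x y → suc (x ℕ.+ y)) |q|≡d |p|≡k ⟩
      suc (d ℕ.+ k)                                ≡⟨ ℕₚ.+-suc d k ⟨
      d ℕ.+ suc k                                  ≡⟨ length-alternating false (d ℕ.+ suc k) ⟨
      length (alternating false (d ℕ.+ suc k))     ∎
      where open ≡-Reasoning
    word-eq : word (alternating false (d ℕ.+ suc k)) ≈ (word q ++ word p) ++ [ s ]
    word-eq = begin
      word (alternating false (d ℕ.+ suc k))       ≡⟨ cong word split ⟩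
      word (q ++ alternating false (suc k))         ≡⟨ map-++ letter q _ ⟩
      word q ++ word (alternating false (suc k))    ≈⟨ ≈-++ (≈-refl {word q}) braid-rel ⟩
      word q ++ word (alternating true (suc k))     ≡⟨ cong (λ u → word q ++ word u) last ⟩
      word q ++ word (p ++ [ true ])                ≡⟨ cong (word q ++_) (map-++ letter p [ true ]) ⟩
      word q ++ (word p ++ [ s ])                   ≡⟨ ++-assoc (word q) (word p) [ s ] ⟨
      (word q ++ word p) ++ [ s ]                   ∎
      where open ≈-Reasoning

  finite-type-dichotomy : ∀ {c c' k} → FiniteType c c' (suc k) → C s s' ≡ c → C s' s ≡ c' → Dichotomy
  finite-type-dichotomy {k = k} ft refl refl n with n ℕ.<? suc k
  ... | yes n<k = inj₂ (_ , coeffs-nonNeg ft n<k , act-alternating-α n)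
  ... | no n≮k with ℕₚ.m≤n⇒∃[o]m+o≡n (ℕₚ.≮⇒≥ n≮k)
  ...   | d , refl = inj₁ (subst (EndsWith-s ∘ alternating false) (ℕₚ.+-comm d (suc k))
                             (beyond-braid-ends-with-s k (braid _ _ (braid-relation ft)) d))

  infinite-type-dichotomy : ∀ a b → 4 ℕ.≤ a ℕ.* b → C s s' ≡ - + a → C s' s ≡ - + b → Dichotomy
  infinite-type-dichotomy a b 4≤ab c≡ c'≡ n = inj₂ (_ ,
    subst₂ (λ c c' → NonNegPair (rootCoeffs c c' n)) (sym c≡) (sym c'≡)
           (InfiniteType.rootCoeffs-nonNeg a b 4≤ab n) ,
    act-alternating-α n)

  dichotomy : C s s' ℤ.≤ +0 → C s' s ℤ.≤ +0 →
              (C s s' ≡ +0 → C s' s ≡ +0) → (C s' s ≡ +0 → C s s' ≡ +0) → Dichotomy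
  dichotomy c≤0 c'≤0 c≡0⇒c'≡0 c'≡0⇒c≡0 with C s s' in c≡ | C s' s in c'≡
  ... | +[1+ _ ] | _        with ℤ.+≤+ () ← c≤0
  ... | _        | +[1+ _ ] with ℤ.+≤+ () ← c'≤0
  ... | +0       | -[1+ _ ] with () ← c≡0⇒c'≡0 refl
  ... | -[1+ _ ] | +0       with () ← c'≡0⇒c≡0 refl
  ... | +0       | +0       = finite-type-dichotomy type-A₁×A₁ c≡ c'≡
  ... | -[1+ 0 ] | -[1+ 0 ] = finite-type-dichotomy type-A₂ c≡ c'≡
  ... | -[1+ 0 ] | -[1+ 1 ] = finite-type-dichotomy type-B₂ c≡ c'≡
  ... | -[1+ 1 ] | -[1+ 0 ] = finite-type-dichotomy type-B₂ᵀ c≡ c'≡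
  ... | -[1+ 0 ] | -[1+ 2 ] = finite-type-dichotomy type-G₂ c≡ c'≡
  ... | -[1+ 2 ] | -[1+ 0 ] = finite-type-dichotomy type-G₂ᵀ c≡ c'≡
  ... | -[1+ 0 ] | -[1+ suc (suc (suc b)) ] =
    infinite-type-dichotomy 1 (4 ℕ.+ b) (s≤s (s≤s (s≤s (s≤s z≤n)))) c≡ c'≡
  ... | -[1+ 1 ] | -[1+ suc b ] =
    infinite-type-dichotomy 2 (2 ℕ.+ b) (ℕₚ.*-mono-≤ {2} {2} {2} ℕₚ.≤-refl (s≤s (s≤s z≤n))) c≡ c'≡
  ... | -[1+ 2 ] | -[1+ suc b ] =
    infinite-type-dichotomy 3 (2 ℕ.+ b) (ℕₚ.*-mono-≤ {2} {3} {2} (s≤s (s≤s z≤n)) (s≤s (s≤s z≤n))) c≡ c'≡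
  ... | -[1+ suc (suc (suc a)) ] | -[1+ b ] =
    infinite-type-dichotomy (4 ℕ.+ a) (suc b)
      (ℕₚ.*-mono-≤ {4} {4 ℕ.+ a} {1} (s≤s (s≤s (s≤s (s≤s z≤n)))) (s≤s z≤n)) c≡ c'≡

  Shortens : List Bool → Set
  Shortens u = Σ (List Bool) λ u' → suc (suc (length u')) ≡ length u × word u ≈ word u'

  classify : ∀ u → Shortens u ⊎ EndsWith-s u ⊎ u ≡ alternating false (length u)
  classify []           = inj₂ (inj₂ refl)
  classify (true ∷ [])  = inj₂ (inj₁ ([] , refl , ≈-refl))
  classify (false ∷ []) = inj₂ (inj₂ refl)
  classify (x ∷ y ∷ r) with classify (y ∷ r)
  ... | inj₁ (u' , |u'|≡ , yr≈u')        = inj₁ (x ∷ u' , cong suc |u'|≡ , ≈-∷ (letter x) yr≈u')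
  ... | inj₂ (inj₁ (p , |p|≡ , yr≈ps))   = inj₂ (inj₁ (letter x ∷ p , cong suc |p|≡ , ≈-∷ (letter x) yr≈ps))
  ... | inj₂ (inj₂ yr-alt) with x Boolₚ.≟ y
  ...   | yes refl = inj₁ (r , refl , ≈-++ {letter x ∷ letter x ∷ []} {[]} (sref-square (letter x)) (≈-refl {word r}))
  ...   | no x≢y   = inj₂ (inj₂ (cong₂ _∷_ (trans (Boolₚ.¬-not x≢y) (cong not (∷-injectiveˡ yr-alt))) yr-alt))

-- Positivity of roots

-- Humphreys, Reflection Groups and Coxeter Groups, Theorem 5.4.
module Positivity {m : ℕ} (C : Matrix m) (C-gcm : IsGCM C) where
  open IsGCM C-gcm
  open WeylGroup C diag

  -- Write w = v · u with u a word in s, s' and ℓ(w) = ℓ(v) + |u|, moving letters into u while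
  -- this shortens v. Then v α_s, v α_s' ≥ 0 by induction, u is reduced, alternating and cannot
  -- be rewritten to end in s, so by the rank-two analysis u α_s ∈ ℕ α_s + ℕ α_s'.
  module Descent (N : ℕ) (IH : ∀ v t → ℓ v ℕ.< N → ℓ v ℕ.≤ ℓ (v ++ [ t ]) → NonNeg (act C v (α t)))
                 {w : Word m} {s s' : Fin m} (s≢s' : s ≢ s')
                 (ℓw≤ℓws : ℓ w ℕ.≤ ℓ (w ++ [ s ])) (ℓw≤N : ℓ w ℕ.≤ N) where
    open RankTwo C diag s s'

    record Split (v : Word m) (u : List Bool) : Set where
      field
        factorisation : w ≈ v ++ word u
        length-sum    : ℓ v ℕ.+ length u ℕ.≤ ℓ w
        nonempty      : 1 ℕ.≤ length u
    open Split

    ¬shortens : ∀ {v u} → Split v u → ¬ Shortens u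
    ¬shortens {v} {u} split (u' , |u|≡ , u≈u') = ℕₚ.<-irrefl refl (begin-strict
      ℓ w                       ≤⟨ ℓ-++-≤ v (≈-trans (factorisation split) (≈-++ (≈-refl {v}) u≈u')) ⟩
      ℓ v ℕ.+ length (word u')  ≡⟨ cong (ℓ v ℕ.+_) (length-map letter u') ⟩
      ℓ v ℕ.+ length u'
        <⟨ ℕₚ.+-monoʳ-< (ℓ v) (ℕₚ.≤-trans (ℕₚ.n≤1+n _) (ℕₚ.≤-reflexive |u|≡)) ⟩
      ℓ v ℕ.+ length u          ≤⟨ length-sum split ⟩
      ℓ w                       ∎)
      where open ℕₚ.≤-Reasoning

    snoc-s-factorisation : ∀ {v u p} → Split v u → word u ≈ p ++ [ s ] → w ++ [ s ] ≈ v ++ p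
    snoc-s-factorisation {v} {u} {p} split u≈ps = begin
      w ++ [ s ]                    ≈⟨ ≈-++ (factorisation split) (≈-refl {[ s ]}) ⟩
      (v ++ word u) ++ [ s ]        ≈⟨ ≈-++ (≈-++ (≈-refl {v}) u≈ps) (≈-refl {[ s ]}) ⟩
      (v ++ (p ++ [ s ])) ++ [ s ]  ≡⟨ cong (_++ [ s ]) (++-assoc v p [ s ]) ⟨
      ((v ++ p) ++ [ s ]) ++ [ s ]  ≈⟨ ++-sref-square (v ++ p) s ⟩
      v ++ p                        ∎
      where open ≈-Reasoning

    ¬endsWith-s : ∀ {v u} → Split v u → ¬ EndsWith-s u
    ¬endsWith-s {v} {u} split (p , |u|≡ , u≈ps) = ℕₚ.<-irrefl refl (begin-strict
      ℓ w                  ≤⟨ ℓw≤ℓws ⟩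
      ℓ (w ++ [ s ])       ≤⟨ ℓ-++-≤ v (snoc-s-factorisation split u≈ps) ⟩
      ℓ v ℕ.+ length p     <⟨ ℕₚ.+-monoʳ-< (ℓ v) (ℕₚ.≤-reflexive |u|≡) ⟩
      ℓ v ℕ.+ length u     ≤⟨ length-sum split ⟩
      ℓ w                  ∎)
      where open ℕₚ.≤-Reasoning

    prepend : ∀ {v u} b → ℓ (v ++ [ letter b ]) ℕ.< ℓ v → Split v u → Split (v ++ [ letter b ]) (b ∷ u)
    prepend {v} {u} b shorter split = record
      { factorisation = let open ≈-Reasoning in begin
          w                                         ≈⟨ factorisation split ⟩
          v ++ word u                               ≈⟨ ≈-++ (++-sref-square v (letter b)) (≈-refl {word u}) ⟨
          ((v ++ [ letter b ]) ++ [ letter b ]) ++ word u ≡⟨ ++-assoc (v ++ [ letter b ]) [ letter b ] (word u) ⟩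
          (v ++ [ letter b ]) ++ word (b ∷ u)       ∎
      ; length-sum = let open ℕₚ.≤-Reasoning in begin
          ℓ (v ++ [ letter b ]) ℕ.+ suc (length u)  ≡⟨ ℕₚ.+-suc _ (length u) ⟩
          suc (ℓ (v ++ [ letter b ])) ℕ.+ length u  ≤⟨ ℕₚ.+-monoˡ-≤ (length u) shorter ⟩
          ℓ v ℕ.+ length u                          ≤⟨ length-sum split ⟩
          ℓ w                                       ∎
      ; nonempty = s≤s z≤n
      }

    nonNeg-from-span : ∀ {v u} → Split v u → NonNeg (act C v (α s)) → NonNeg (act C v (α s')) →
                       NonNegSpan u → NonNeg (act C w (α s))
    nonNeg-from-span {v} {u} split vα≥0 vα'≥0 ((X , Y) , (0≤X , 0≤Y) , u-span) t =
      subst (+0 ℤ.≤_) (sym wα≡) (ℤₚ.+-mono-≤ (nonNeg-* 0≤X (vα≥0 t)) (nonNeg-* 0≤Y (vα'≥0 t)))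
      where
      open ≡-Reasoning
      wα≡ : act C w (α s) t ≡ X * act C v (α s) t + Y * act C v (α s') t
      wα≡ = begin
        act C w (α s) t                                      ≡⟨ act-≗ (factorisation split) (α s) t ⟩
        act C (v ++ word u) (α s) t                          ≡⟨ cong (λ ν → ν t) (act-++ C v (word u) (α s)) ⟩
        act C v (act C (word u) (α s)) t                     ≡⟨ act-cong C v u-span t ⟩
        act C v (span (X , Y)) t                             ≡⟨ act-+ C v (λ t → X * α s t) (λ t → Y * α s' t) t ⟩
        act C v (λ t → X * α s t) t + act C v (λ t → Y * α s' t) t
          ≡⟨ cong₂ _+_ (act-* C v X (α s) t) (act-* C v Y (α s') t) ⟩
        X * act C v (α s) t + Y * act C v (α s') t           ∎

    terminal : ∀ {v u} → Split v u → ℓ v ℕ.≤ ℓ (v ++ [ s ]) → ℓ v ℕ.≤ ℓ (v ++ [ s' ]) →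
               NonNeg (act C w (α s))
    terminal {v} {u} split ℓv≤ℓvs ℓv≤ℓvs' with classify u
    ... | inj₁ shortens        = ⊥-elim (¬shortens split shortens)
    ... | inj₂ (inj₁ endsWith) = ⊥-elim (¬endsWith-s split endsWith)
    ... | inj₂ (inj₂ u-alt) with dichotomy (offdiag s s' s≢s') (offdiag s' s (s≢s' ∘ sym))
                                           (zero-sym s s') (zero-sym s' s) (length u)
    ...   | inj₁ endsWith = ⊥-elim (¬endsWith-s split (subst EndsWith-s (sym u-alt) endsWith))
    ...   | inj₂ nonNegSpan =
      nonNeg-from-span split (IH v s ℓv<N ℓv≤ℓvs) (IH v s' ℓv<N ℓv≤ℓvs') (subst NonNegSpan (sym u-alt) nonNegSpan)
      where
      ℓv<N : ℓ v ℕ.< N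
      ℓv<N = let open ℕₚ.≤-Reasoning in begin-strict
        ℓ v                 <⟨ ℕₚ.n<1+n (ℓ v) ⟩
        suc (ℓ v)           ≡⟨ ℕₚ.+-comm 1 (ℓ v) ⟩
        ℓ v ℕ.+ 1           ≤⟨ ℕₚ.+-monoʳ-≤ (ℓ v) (nonempty split) ⟩
        ℓ v ℕ.+ length u    ≤⟨ length-sum split ⟩
        ℓ w                 ≤⟨ ℓw≤N ⟩
        N                   ∎

    descend : ∀ F {v u} → ℓ v ℕ.< F → Split v u → NonNeg (act C w (α s))
    descend zero    () _
    descend (suc F) {v} ℓv<1+F split with ℓ (v ++ [ s ]) ℕ.<? ℓ v
    ... | yes shorter = descend F (ℕₚ.<-≤-trans shorter (ℕₚ.≤-pred ℓv<1+F)) (prepend true shorter split)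
    ... | no ℓvs≮ℓv with ℓ (v ++ [ s' ]) ℕ.<? ℓ v
    ...   | yes shorter = descend F (ℕₚ.<-≤-trans shorter (ℕₚ.≤-pred ℓv<1+F)) (prepend false shorter split)
    ...   | no ℓvs'≮ℓv  = terminal split (ℕₚ.≮⇒≥ ℓvs≮ℓv) (ℕₚ.≮⇒≥ ℓvs'≮ℓv)

  nonNeg-below : ∀ N w s → ℓ w ℕ.< N → ℓ w ℕ.≤ ℓ (w ++ [ s ]) → NonNeg (act C w (α s))
  nonNeg-below zero    w s () _
  nonNeg-below (suc N) w s ℓw<1+N ℓw≤ℓws with reduced-word w
  ... | r , |r|≡ℓw , r≈w with initLast r
  ... | [] = λ t → subst (+0 ℤ.≤_) (act-≗ r≈w (α s) t) (α-nonNeg s t)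
  ... | r' ∷ʳ′ s' with s ≟ s'
  ...   | yes refl = ⊥-elim (ℕₚ.<-irrefl refl (begin-strict
          ℓ w                ≤⟨ ℓw≤ℓws ⟩
          ℓ (w ++ [ s ])     ≡⟨ ℓ-cong ws≈r' ⟩
          ℓ r'               ≤⟨ ℓ-≤-length-self r' ⟩
          length r'          <⟨ ℕₚ.m<m+n (length r') (s≤s z≤n) ⟩
          length r' ℕ.+ 1    ≡⟨ length-++ r' {[ s ]} ⟨
          length (r' ++ [ s ]) ≡⟨ |r|≡ℓw ⟩
          ℓ w                ∎))
    where
    open ℕₚ.≤-Reasoning
    ws≈r' : w ++ [ s ] ≈ r'
    ws≈r' = ≈-trans (≈-++ (≈-sym r≈w) (≈-refl {[ s ]})) (++-sref-square r' s)
  ...   | no s≢s' = descend (suc (ℓ r')) (ℕₚ.n<1+n (ℓ r')) split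
    where
    open Descent N (nonNeg-below N) s≢s' ℓw≤ℓws (ℕₚ.≤-pred ℓw<1+N)
    split : Split r' [ false ]
    split = record
      { factorisation = ≈-sym r≈w
      ; length-sum = subst (ℓ r' ℕ.+ 1 ℕ.≤_) (trans (sym (length-++ r' {[ s' ]})) |r|≡ℓw)
                       (ℕₚ.+-monoˡ-≤ 1 (ℓ-≤-length-self r'))
      ; nonempty = s≤s z≤n
      }

  ℓ-≤-snoc⇒nonNeg : ∀ w s → ℓ w ℕ.≤ ℓ (w ++ [ s ]) → NonNeg (act C w (α s))
  ℓ-≤-snoc⇒nonNeg w s = nonNeg-below (suc (ℓ w)) w s (ℕₚ.n<1+n (ℓ w))

  ℓ-snoc-≤⇒nonPos : ∀ w s → ℓ (w ++ [ s ]) ℕ.≤ ℓ w → NonPos (act C w (α s))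
  ℓ-snoc-≤⇒nonPos w s ℓws≤ℓw t = nonNeg-neg⇒nonPos (subst (+0 ℤ.≤_) (act-snoc-α w s t)
    (ℓ-≤-snoc⇒nonNeg (w ++ [ s ]) s (subst (ℓ (w ++ [ s ]) ℕ.≤_) (sym (ℓ-cong (++-sref-square w s))) ℓws≤ℓw) t))

  nonNeg⊎nonPos : ∀ w s → NonNeg (act C w (α s)) ⊎ NonPos (act C w (α s))
  nonNeg⊎nonPos w s with ℓ w ℕ.≤? ℓ (w ++ [ s ])
  ... | yes ℓw≤ℓws = inj₁ (ℓ-≤-snoc⇒nonNeg w s ℓw≤ℓws)
  ... | no ℓw≰ℓws  = inj₂ (ℓ-snoc-≤⇒nonPos w s (ℕₚ.<⇒≤ (ℕₚ.≰⇒> ℓw≰ℓws)))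

  nonNeg⇒ℓ-snoc : ∀ w s → NonNeg (act C w (α s)) → ℓ (w ++ [ s ]) ≡ suc (ℓ w)
  nonNeg⇒ℓ-snoc w s wα≥0 with ℓ (w ++ [ s ]) ℕ.≤? ℓ w
  ... | no ℓws≰ℓw  = ℕₚ.≤-antisym (ℓ-snoc w s) (ℕₚ.≰⇒> ℓws≰ℓw)
  ... | yes ℓws≤ℓw =
    ⊥-elim (act-α-nonzero w s λ t → ℤₚ.≤-antisym (ℓ-snoc-≤⇒nonPos w s ℓws≤ℓw t) (wα≥0 t))

  ℓ-∷ : ∀ k x → ℓ (k ∷ x) ≡ ℓ (reverse x ++ [ k ])
  ℓ-∷ k x = trans (sym (ℓ-reverse (k ∷ x))) (cong ℓ (unfold-reverse k x))

  cover⇒nonNeg : ∀ {x k} → Cover C x k → NonNeg (act C (reverse x) (α k))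
  cover⇒nonNeg {x} {k} (l , ℓx≡l , ℓkx≡1+l) = ℓ-≤-snoc⇒nonNeg (reverse x) k (begin
    ℓ (reverse x)           ≡⟨ ℓ-reverse x ⟩
    ℓ x                     ≡⟨ hasLength⇒≡ℓ ℓx≡l ⟩
    l                       ≤⟨ ℕₚ.n≤1+n l ⟩
    suc l                   ≡⟨ hasLength⇒≡ℓ ℓkx≡1+l ⟨
    ℓ (k ∷ x)               ≡⟨ ℓ-∷ k x ⟩
    ℓ (reverse x ++ [ k ])  ∎)
    where open ℕₚ.≤-Reasoning

  nonNeg⇒cover : ∀ {x k} → NonNeg (act C (reverse x) (α k)) → Cover C x k
  nonNeg⇒cover {x} {k} x⁻¹α≥0 =
    ℓ x , ℓ-hasLength x , subst (HasLength C (k ∷ x)) ℓkx≡1+ℓx (ℓ-hasLength (k ∷ x))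
    where
    ℓkx≡1+ℓx : ℓ (k ∷ x) ≡ suc (ℓ x)
    ℓkx≡1+ℓx = begin
      ℓ (k ∷ x)                 ≡⟨ ℓ-∷ k x ⟩
      ℓ (reverse x ++ [ k ])    ≡⟨ nonNeg⇒ℓ-snoc (reverse x) k x⁻¹α≥0 ⟩
      suc (ℓ (reverse x))       ≡⟨ cong suc (ℓ-reverse x) ⟩
      suc (ℓ x)                 ∎
      where open ≡-Reasoning

module _ {m n : ℕ} (ρ : Fin m → Fin n) (i : Fin n) where

  restrict : (Fin m → ℤ) → Fin m → ℤ
  restrict g j = if does (ρ j ≟ i) then g j else +0

  restrict-in : ∀ g {j} → ρ j ≡ i → restrict g j ≡ g j
  restrict-in g {j} ρj≡i with ρ j ≟ i
  ... | yes _    = refl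
  ... | no ρj≢i = ⊥-elim (ρj≢i ρj≡i)

  restrict-out : ∀ g {j} → ρ j ≢ i → restrict g j ≡ +0
  restrict-out g {j} ρj≢i with ρ j ≟ i
  ... | yes ρj≡i = ⊥-elim (ρj≢i ρj≡i)
  ... | no _     = refl

  restrict-cong : ∀ {g h} → (∀ j → ρ j ≡ i → g j ≡ h j) → restrict g ≗ restrict h
  restrict-cong {g} {h} g≡h j with ρ j ≟ i
  ... | yes ρj≡i = g≡h j ρj≡i
  ... | no _     = refl

  restrict-nonPos : ∀ {g} → (∀ j → ρ j ≡ i → g j ℤ.≤ +0) → ∀ j → restrict g j ℤ.≤ +0
  restrict-nonPos g≤0 j with ρ j ≟ i
  ... | yes ρj≡i = g≤0 j ρj≡i
  ... | no _     = ℤₚ.≤-refl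

  orbitSum-cong : ∀ {g h} → (∀ j → ρ j ≡ i → g j ≡ h j) → orbitSum ρ i g ≡ orbitSum ρ i h
  orbitSum-cong g≡h = sumℤ-cong (restrict-cong g≡h)

  orbitSum-distribˡ-* : ∀ c g → orbitSum ρ i (λ j → c * g j) ≡ c * orbitSum ρ i g
  orbitSum-distribˡ-* c g = trans (sumℤ-cong pointwise) (sumℤ-distribˡ-* c (restrict g))
    where
    pointwise : ∀ j → restrict (λ j → c * g j) j ≡ c * restrict g j
    pointwise j with ρ j ≟ i
    ... | yes _ = refl
    ... | no _  = sym (ℤₚ.*-zeroʳ c)

  orbitSum-zero : ∀ {g} → (∀ j → ρ j ≡ i → g j ≡ +0) → orbitSum ρ i g ≡ +0
  orbitSum-zero {g} g≡0 = trans (orbitSum-cong {h = λ j → +0 * g j} g≡0) (orbitSum-distribˡ-* +0 g)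

  orbitSum-supported-at : ∀ g {j₀} → ρ j₀ ≡ i → (∀ j → ρ j ≡ i → j ≢ j₀ → g j ≡ +0) →
                          orbitSum ρ i g ≡ g j₀
  orbitSum-supported-at g {j₀} ρj₀≡i g≡0 =
    trans (sumℤ-supported-at (restrict g) j₀ vanishes) (restrict-in g ρj₀≡i)
    where
    vanishes : ∀ j → j ≢ j₀ → restrict g j ≡ +0
    vanishes j j≢j₀ with ρ j ≟ i
    ... | yes ρj≡i = g≡0 j ρj≡i j≢j₀
    ... | no _     = refl

  orbitSum-nonPos : ∀ {g} → (∀ j → ρ j ≡ i → g j ℤ.≤ +0) → orbitSum ρ i g ℤ.≤ +0
  orbitSum-nonPos g≤0 = sumℤ-nonPos _ (restrict-nonPos g≤0)

  orbitSum-nonPos-zero : ∀ {g} → (∀ j → ρ j ≡ i → g j ℤ.≤ +0) → orbitSum ρ i g ≡ +0 →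
                         ∀ j → ρ j ≡ i → g j ≡ +0
  orbitSum-nonPos-zero {g} g≤0 Σ≡0 j ρj≡i =
    trans (sym (restrict-in g ρj≡i)) (sumℤ-nonPos-zero _ (restrict-nonPos g≤0) Σ≡0 j)

sumℤ-by-orbits : ∀ {m n} (ρ : Fin m → Fin n) (g : Fin m → ℤ) → sumℤ g ≡ sumℤ (λ i → orbitSum ρ i g)
sumℤ-by-orbits ρ g = sym (begin
  sumℤ (λ i → sumℤ (λ j → restrict ρ i g j))  ≡⟨ sumℤ-comm (λ i j → restrict ρ i g j) ⟩
  sumℤ (λ j → sumℤ (λ i → restrict ρ i g j))  ≡⟨ sumℤ-cong own-orbit ⟩
  sumℤ g                                      ∎)
  where
  open ≡-Reasoning
  own-orbit : ∀ j → sumℤ (λ i → restrict ρ i g j) ≡ g j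
  own-orbit j = trans
    (sumℤ-supported-at (λ i → restrict ρ i g j) (ρ j) (λ i i≢ρj → restrict-out ρ i g (i≢ρj ∘ sym)))
    (restrict-in ρ (ρ j) g refl)

orbitSize-pos : ∀ {m n} (ρ : Fin m → Fin n) j → 1 ℕ.≤ orbitSize ρ (ρ j)
orbitSize-pos ρ zero with ρ zero ≟ ρ zero
... | yes _ = s≤s z≤n
... | no ρ0≢ρ0 = ⊥-elim (ρ0≢ρ0 refl)
orbitSize-pos ρ (suc j) = ℕₚ.≤-trans (orbitSize-pos (ρ ∘ suc) j) (ℕₚ.m≤n+m _ _)

-- Folding

module Unfolding {m n : ℕ} (F : Folding m n) where
  open Folding F
  open IsGCM B-GCM renaming (diag to B-diag; offdiag to B-offdiag; zero-sym to B-zero-sym)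
  open WeylGroup B B-diag using (sref-negates-α; act-α-nonzero)
  open Positivity B B-GCM using (nonNeg⊎nonPos; nonNeg⇒cover)

  o : Fin n → ℕ
  o = orbitSize ρ

  o-pos : ∀ i → 1 ℕ.≤ o i
  o-pos i with ρ-surj i
  ... | j , refl = orbitSize-pos ρ j

  same-orbit : ∀ {j k} → ρ j ≡ ρ k → ∃ λ r → iter π r j ≡ k
  same-orbit {j} {k} = proj₁ (ρ-orbit j k)

  ρ-iter : ∀ r j → ρ (iter π r j) ≡ ρ j
  ρ-iter r j = sym (proj₂ (ρ-orbit j (iter π r j)) (r , refl))

  B-iter : ∀ r j k → B (iter π r j) (iter π r k) ≡ B j k
  B-iter zero    j k = refl
  B-iter (suc r) j k = trans (π-auto (iter π r j) (iter π r k)) (B-iter r j k)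

  other-orbits-distinct : ∀ {i i' j t} → i' ≢ i → ρ j ≡ i' → ρ t ≡ i → j ≢ t
  other-orbits-distinct i'≢i ρj≡i' ρt≡i j≡t = i'≢i (trans (sym ρj≡i') (trans (cong ρ j≡t) ρt≡i))

  orbitSum-self : ∀ {i j} → ρ j ≡ i → orbitSum ρ i (B j) ≡ + 2
  orbitSum-self {i} {j} ρj≡i = trans
    (orbitSum-supported-at ρ i (B j) ρj≡i
      (λ t ρt≡i t≢j → π-admissible j t (trans ρj≡i (sym ρt≡i)) (t≢j ∘ sym)))
    (B-diag j)

  orbitSum-other-nonPos : ∀ {i' i j} → i' ≢ i → ρ j ≡ i' → orbitSum ρ i (B j) ℤ.≤ +0
  orbitSum-other-nonPos {i'} {i} {j} i'≢i ρj≡i' =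
    orbitSum-nonPos ρ i (λ t ρt≡i → B-offdiag j t (other-orbits-distinct i'≢i ρj≡i' ρt≡i))

  A≡0⇔orbitSum≡0 : ∀ {i' i j} → ρ j ≡ i' →
                   (A i' i ≡ +0 → orbitSum ρ i (B j) ≡ +0) × (orbitSum ρ i (B j) ≡ +0 → A i' i ≡ +0)
  A≡0⇔orbitSum≡0 {i'} {i} {j} ρj≡i' =
    (λ A≡0 → *-cancel-pos (o-pos i') (begin
      + o i' * orbitSum ρ i (B j)  ≡⟨ A-def i' i j ρj≡i' ⟨
      + o i * A i' i               ≡⟨ cong (+ o i *_) A≡0 ⟩
      + o i * +0                   ≡⟨ ℤₚ.*-zeroʳ (+ o i) ⟩
      +0                           ≡⟨ ℤₚ.*-zeroʳ (+ o i') ⟨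
      + o i' * +0                  ∎)) ,
    (λ Σ≡0 → *-cancel-pos (o-pos i) (begin
      + o i * A i' i               ≡⟨ A-def i' i j ρj≡i' ⟩
      + o i' * orbitSum ρ i (B j)  ≡⟨ cong (+ o i' *_) Σ≡0 ⟩
      + o i' * +0                  ≡⟨ ℤₚ.*-zeroʳ (+ o i') ⟩
      +0                           ≡⟨ ℤₚ.*-zeroʳ (+ o i) ⟨
      + o i * +0                   ∎))
    where open ≡-Reasoning

  A-diag : ∀ i → A i i ≡ + 2
  A-diag i with ρ-surj i
  ... | j , ρj≡i = *-cancel-pos (o-pos i) (trans (A-def i i j ρj≡i) (cong (+ o i *_) (orbitSum-self ρj≡i)))

  A-offdiag : ∀ i' i → i' ≢ i → A i' i ℤ.≤ +0
  A-offdiag i' i i'≢i with ρ-surj i'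
  ... | j , ρj≡i' = *-nonPos⁻¹ (o-pos i)
    (subst (ℤ._≤ +0) (sym (A-def i' i j ρj≡i')) (*-nonPos (o i') (orbitSum-other-nonPos i'≢i ρj≡i')))

  A-zero-sym : ∀ i' i → A i' i ≡ +0 → A i i' ≡ +0
  A-zero-sym i' i A≡0 with i' ≟ i
  ... | yes refl = ⊥-elim (2≢0 (trans (sym (A-diag i')) A≡0))
    where
    2≢0 : + 2 ≢ +0
    2≢0 ()
  ... | no i'≢i with ρ-surj i' | ρ-surj i
  ... | j , ρj≡i' | l , ρl≡i = proj₂ (A≡0⇔orbitSum≡0 ρl≡i) (orbitSum-zero ρ i' Blt≡0)
    where
    Bjt≡0 : ∀ t → ρ t ≡ i → B j t ≡ +0
    Bjt≡0 = orbitSum-nonPos-zero ρ i (λ t ρt≡i → B-offdiag j t (other-orbits-distinct i'≢i ρj≡i' ρt≡i))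
                                     (proj₁ (A≡0⇔orbitSum≡0 ρj≡i') A≡0)
    -- move t to j along the orbit, carrying l along
    Blt≡0 : ∀ t → ρ t ≡ i' → B l t ≡ +0
    Blt≡0 t ρt≡i' with same-orbit (trans ρt≡i' (sym ρj≡i'))
    ... | r , πʳt≡j = B-zero-sym t l (begin
      B t l                          ≡⟨ B-iter r t l ⟨
      B (iter π r t) (iter π r l)    ≡⟨ cong (λ x → B x (iter π r l)) πʳt≡j ⟩
      B j (iter π r l)               ≡⟨ Bjt≡0 (iter π r l) (trans (ρ-iter r l) ρl≡i) ⟩
      +0                             ∎)
      where open ≡-Reasoning

  A-isGCM : IsGCM A
  A-isGCM = record { diag = A-diag ; offdiag = A-offdiag ; zero-sym = A-zero-sym }

  orbitReflection : Fin n → Q m → Q m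
  orbitReflection k ν t = if does (ρ t ≟ k) then ν t - pairing B t ν else ν t

  act-reverse-orbit : ∀ {k} (L : Word m) → All (λ j → ρ j ≡ k) L → Unique L → ∀ ν t →
    (t ∈ L → act B (reverse L) ν t ≡ ν t - pairing B t ν) × (t ∉ L → act B (reverse L) ν t ≡ ν t)
  act-reverse-orbit []      _ _ ν t = (λ ()) , (λ _ → refl)
  act-reverse-orbit {k} (j ∷ L) (ρj≡k ∷ L-in-orbit) (j∉L ∷ L-unique) ν t = ∈-case , ∉-case
    where
    open ≡-Reasoning
    ν′ = sref B j ν
    IH = act-reverse-orbit L L-in-orbit L-unique ν′ t
    unfold : act B (reverse (j ∷ L)) ν t ≡ act B (reverse L) ν′ t
    unfold = cong (λ μ → μ t) (act-reverse-∷ B j L ν)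
    ∈-case : t ∈ j ∷ L → act B (reverse (j ∷ L)) ν t ≡ ν t - pairing B t ν
    ∈-case (here refl) =
      trans unfold (trans (proj₂ IH (λ t∈L → All.lookup j∉L t∈L refl)) (sref-self B t ν))
    ∈-case (there t∈L) = begin
      act B (reverse (j ∷ L)) ν t                       ≡⟨ unfold ⟩
      act B (reverse L) ν′ t                            ≡⟨ proj₁ IH t∈L ⟩
      ν′ t - pairing B t ν′                             ≡⟨ cong₂ _-_ (sref-other B ν t≢j) (pairing-sref B t j ν) ⟩
      ν t - (pairing B t ν - pairing B j ν * B t j)
        ≡⟨ cong (λ b → ν t - (pairing B t ν - pairing B j ν * b)) Btj≡0 ⟩
      ν t - (pairing B t ν - pairing B j ν * +0)        ≡⟨ drop (ν t) (pairing B t ν) (pairing B j ν) ⟩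
      ν t - pairing B t ν                               ∎
      where
      t≢j : t ≢ j
      t≢j t≡j = All.lookup j∉L t∈L (sym t≡j)
      Btj≡0 : B t j ≡ +0
      Btj≡0 = π-admissible t j (trans (All.lookup L-in-orbit t∈L) (sym ρj≡k)) t≢j
      drop : ∀ a b c → a - (b - c * +0) ≡ a - b
      drop = solve-∀
    ∉-case : t ∉ j ∷ L → act B (reverse (j ∷ L)) ν t ≡ ν t
    ∉-case t∉jL = trans unfold (trans (proj₂ IH (t∉jL ∘ there)) (sref-other B ν (t∉jL ∘ here)))

  act-reverse-orbitList : ∀ k ν → act B (reverse (orbitList ρ k)) ν ≗ orbitReflection k ν
  act-reverse-orbitList k ν t
    with ρ t ≟ k | act-reverse-orbit (orbitList ρ k) (Allₚ.all-filter in-O (allFin m))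
                                     (Uniqueₚ.filter⁺ in-O (Uniqueₚ.allFin⁺ m)) ν t
    where
    in-O : ∀ j → Dec (ρ j ≡ k)
    in-O j = ρ j ≟ k
  ... | yes ρt≡k | in-L , _ = in-L (∈-filter⁺ (λ j → ρ j ≟ k) (∈-allFin t) ρt≡k)
  ... | no ρt≢k  | _ , ∉-L = ∉-L (λ t∈L → ρt≢k (proj₂ (∈-filter⁻ (λ j → ρ j ≟ k) {xs = allFin m} t∈L)))

  act-reverse-f-∷ : ∀ k v ν → act B (reverse (f (k ∷ v))) ν ≗ act B (reverse (f v)) (orbitReflection k ν)
  act-reverse-f-∷ k v ν t = begin
    act B (reverse (orbitList ρ k ++ f v)) ν t
      ≡⟨ cong (λ w → act B w ν t) (reverse-++ (orbitList ρ k) (f v)) ⟩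
    act B (reverse (f v) ++ reverse (orbitList ρ k)) ν t          ≡⟨ cong (λ μ → μ t) (act-++ B (reverse (f v)) _ ν) ⟩
    act B (reverse (f v)) (act B (reverse (orbitList ρ k)) ν) t
      ≡⟨ act-cong B (reverse (f v)) (act-reverse-orbitList k ν) t ⟩
    act B (reverse (f v)) (orbitReflection k ν) t                 ∎
    where open ≡-Reasoning

  -- ν is constant on the orbits, and μ = Σ_t ν_t α_{ρ t}
  Lifts : Q n → Q m → Set
  Lifts μ ν = ∀ t → + o (ρ t) * ν t ≡ μ (ρ t)

  pairing-lift : ∀ {μ ν} → Lifts μ ν → ∀ {t k} → ρ t ≡ k → + o k * pairing B t ν ≡ pairing A k μ
  pairing-lift {μ} {ν} lift {t} {k} ρt≡k = sym (begin
    sumℤ (λ k' → A k k' * μ k')                                 ≡⟨ sumℤ-cong per-orbit ⟩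
    sumℤ (λ k' → + o k * orbitSum ρ k' (λ l → B t l * ν l))
      ≡⟨ sumℤ-distribˡ-* (+ o k) (λ k' → orbitSum ρ k' (λ l → B t l * ν l)) ⟩
    + o k * sumℤ (λ k' → orbitSum ρ k' (λ l → B t l * ν l))     ≡⟨ cong (+ o k *_) (sumℤ-by-orbits ρ _) ⟨
    + o k * pairing B t ν                                       ∎)
    where
    open ≡-Reasoning
    per-orbit : ∀ k' → A k k' * μ k' ≡ + o k * orbitSum ρ k' (λ l → B t l * ν l)
    per-orbit k' = *-cancel-pos (o-pos k') (begin
      + o k' * (A k k' * μ k')                                  ≡⟨ ℤₚ.*-assoc (+ o k') (A k k') (μ k') ⟨
      + o k' * A k k' * μ k'                                    ≡⟨ cong (_* μ k') (A-def k k' t ρt≡k) ⟩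
      + o k * orbitSum ρ k' (B t) * μ k'                        ≡⟨ regroup (+ o k) (orbitSum ρ k' (B t)) (μ k') ⟩
      + o k * (μ k' * orbitSum ρ k' (B t))
        ≡⟨ cong (+ o k *_) (orbitSum-distribˡ-* ρ k' (μ k') (B t)) ⟨
      + o k * orbitSum ρ k' (λ l → μ k' * B t l)                ≡⟨ cong (+ o k *_) (orbitSum-cong ρ k' unfold-μ) ⟩
      + o k * orbitSum ρ k' (λ l → + o k' * (B t l * ν l))
        ≡⟨ cong (+ o k *_) (orbitSum-distribˡ-* ρ k' (+ o k') _) ⟩
      + o k * (+ o k' * orbitSum ρ k' (λ l → B t l * ν l))      ≡⟨ swap (+ o k) (+ o k') _ ⟩
      + o k' * (+ o k * orbitSum ρ k' (λ l → B t l * ν l))      ∎)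
      where
      regroup : ∀ a b c → a * b * c ≡ a * (c * b)
      regroup = solve-∀
      swap : ∀ a b c → a * (b * c) ≡ b * (a * c)
      swap = solve-∀
      unfold-μ : ∀ l → ρ l ≡ k' → μ k' * B t l ≡ + o k' * (B t l * ν l)
      unfold-μ l refl = begin
        μ (ρ l) * B t l               ≡⟨ cong (_* B t l) (lift l) ⟨
        + o (ρ l) * ν l * B t l       ≡⟨ rearrange (+ o (ρ l)) (ν l) (B t l) ⟩
        + o (ρ l) * (B t l * ν l)     ∎
        where
        rearrange : ∀ a b c → a * b * c ≡ a * (c * b)
        rearrange = solve-∀

  lifts-sref : ∀ {μ ν} k → Lifts μ ν → Lifts (sref A k μ) (orbitReflection k ν)
  lifts-sref {μ} {ν} k lift t with ρ t ≟ k
  ... | no _     = lift t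
  ... | yes ρt≡k = begin
    + o (ρ t) * (ν t - pairing B t ν)                   ≡⟨ distrib (+ o (ρ t)) (ν t) (pairing B t ν) ⟩
    + o (ρ t) * ν t - + o (ρ t) * pairing B t ν
      ≡⟨ cong₂ _-_ (lift t) (trans (cong (λ z → + o z * pairing B t ν) ρt≡k) (pairing-lift lift ρt≡k)) ⟩
    μ (ρ t) - pairing A k μ                             ∎
    where
    open ≡-Reasoning
    distrib : ∀ a b c → a * (b - c) ≡ a * b - a * c
    distrib = solve-∀

  lifts-act : ∀ v {μ ν} → Lifts μ ν → Lifts (act A (reverse v) μ) (act B (reverse (f v)) ν)
  lifts-act []      lift = lift
  lifts-act (k ∷ v) {μ} {ν} lift t = begin
    + o (ρ t) * act B (reverse (f (k ∷ v))) ν t                ≡⟨ cong (+ o (ρ t) *_) (act-reverse-f-∷ k v ν t) ⟩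
    + o (ρ t) * act B (reverse (f v)) (orbitReflection k ν) t
      ≡⟨ lifts-act v {sref A k μ} {orbitReflection k ν} (lifts-sref {μ} {ν} k lift) t ⟩
    act A (reverse v) (sref A k μ) (ρ t)                       ≡⟨ cong (λ μ′ → μ′ (ρ t)) (act-reverse-∷ A k v μ) ⟨
    act A (reverse (k ∷ v)) μ (ρ t)                            ∎
    where open ≡-Reasoning

  π⃗ : Fin m → Fin m
  π⃗ t = π ⟨$⟩ʳ t

  π⃗-injective : ∀ {a b} → π⃗ a ≡ π⃗ b → a ≡ b
  π⃗-injective π⃗a≡π⃗b = trans (sym (inverseˡ π)) (trans (cong (π ⟨$⟩ˡ_) π⃗a≡π⃗b) (inverseˡ π))

  ρ-π : ∀ t → ρ (π⃗ t) ≡ ρ t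
  ρ-π t = ρ-iter 1 t

  pairing-π : ∀ t ν → pairing B t (ν ∘ π⃗) ≡ pairing B (π⃗ t) ν
  pairing-π t ν = trans (sumℤ-cong (λ l → cong (_* ν (π⃗ l)) (sym (π-auto t l))))
                        (sumℤ-permute (λ l → B (π⃗ t) l * ν l) π)

  orbitReflection-π : ∀ k ν → orbitReflection k (ν ∘ π⃗) ≗ orbitReflection k ν ∘ π⃗
  orbitReflection-π k ν t rewrite ρ-π t with ρ t ≟ k
  ... | yes _ = cong (_-_ (ν (π⃗ t))) (pairing-π t ν)
  ... | no _  = refl

  act-f-π : ∀ v ν → act B (reverse (f v)) (ν ∘ π⃗) ≗ act B (reverse (f v)) ν ∘ π⃗
  act-f-π []      ν t = refl
  act-f-π (k ∷ v) ν t = begin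
    act B (reverse (f (k ∷ v))) (ν ∘ π⃗) t                ≡⟨ act-reverse-f-∷ k v (ν ∘ π⃗) t ⟩
    act B (reverse (f v)) (orbitReflection k (ν ∘ π⃗)) t  ≡⟨ act-cong B (reverse (f v)) (orbitReflection-π k ν) t ⟩
    act B (reverse (f v)) (orbitReflection k ν ∘ π⃗) t    ≡⟨ act-f-π v (orbitReflection k ν) t ⟩
    act B (reverse (f v)) (orbitReflection k ν) (π⃗ t)    ≡⟨ act-reverse-f-∷ k v ν (π⃗ t) ⟨
    act B (reverse (f (k ∷ v))) ν (π⃗ t)                  ∎
    where open ≡-Reasoning

  α-π : ∀ j → α j ≗ α (π⃗ j) ∘ π⃗
  α-π j t with t ≟ j
  ... | yes refl = sym (α-self (π⃗ t))
  ... | no t≢j   = sym (α-other (t≢j ∘ π⃗-injective))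

  nonPos-π : ∀ v j → NonPos (act B (reverse (f v)) (α j)) → NonPos (act B (reverse (f v)) (α (π⃗ j)))
  nonPos-π v j nonPos t = subst (ℤ._≤ +0) moved (nonPos (π ⟨$⟩ˡ t))
    where
    open ≡-Reasoning
    W = reverse (f v)
    moved : act B W (α j) (π ⟨$⟩ˡ t) ≡ act B W (α (π⃗ j)) t
    moved = begin
      act B W (α j) (π ⟨$⟩ˡ t)                 ≡⟨ act-cong B W (α-π j) (π ⟨$⟩ˡ t) ⟩
      act B W (α (π⃗ j) ∘ π⃗) (π ⟨$⟩ˡ t)        ≡⟨ act-f-π v (α (π⃗ j)) (π ⟨$⟩ˡ t) ⟩
      act B W (α (π⃗ j)) (π⃗ (π ⟨$⟩ˡ t))        ≡⟨ cong (act B W (α (π⃗ j))) (inverseʳ π) ⟩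
      act B W (α (π⃗ j)) t                      ∎

  nonPos-orbit : ∀ v {j j'} → ρ j ≡ ρ j' →
                 NonPos (act B (reverse (f v)) (α j)) → NonPos (act B (reverse (f v)) (α j'))
  nonPos-orbit v {j} ρj≡ρj' nonPos with same-orbit ρj≡ρj'
  ... | r , refl = along r
    where
    along : ∀ r → NonPos (act B (reverse (f v)) (α (iter π r j)))
    along zero    = nonPos
    along (suc r) = nonPos-π v (iter π r j) (along r)

  nonNeg-unfold : ∀ v {i j} → ρ j ≡ i →
                  NonNeg (act A (reverse v) (α i)) → NonNeg (act B (reverse (f v)) (α j))
  nonNeg-unfold v {i} {j} ρj≡i v⁻¹α≥0 with nonNeg⊎nonPos (reverse (f v)) j
  ... | inj₁ nonNeg = nonNeg
  ... | inj₂ nonPos = ⊥-elim (act-α-nonzero W j vanishes)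
    where
    W = reverse (f v)
    β-sum : Q m
    β-sum t = α i (ρ t)
    lift : Lifts (λ k → + o i * α i k) β-sum
    lift t with ρ t ≟ i
    ... | yes ρt≡i = cong (λ k → + o k * + 1) ρt≡i
    ... | no _     = trans (ℤₚ.*-zeroʳ (+ o (ρ t))) (sym (ℤₚ.*-zeroʳ (+ o i)))
    Wβ-sum≥0 : NonNeg (act B W β-sum)
    Wβ-sum≥0 t =
      *-nonNeg⁻¹ (o-pos (ρ t)) (subst (+0 ℤ.≤_) (sym lifted) (nonNeg-* {+ o i} (ℤ.+≤+ z≤n) (v⁻¹α≥0 (ρ t))))
      where
      lifted : + o (ρ t) * act B W β-sum t ≡ + o i * act A (reverse v) (α i) (ρ t)
      lifted = trans (lifts-act v {λ k → + o i * α i k} {β-sum} lift t) (act-* A (reverse v) (+ o i) (α i) (ρ t))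
    terms≤0 : ∀ t j' → β-sum j' * act B W (α j') t ℤ.≤ +0
    terms≤0 t j' with ρ j' ≟ i
    ... | yes ρj'≡i = subst (ℤ._≤ +0) (sym (ℤₚ.*-identityˡ _)) (nonPos-orbit v (trans ρj≡i (sym ρj'≡i)) nonPos t)
    ... | no _      = ℤₚ.≤-refl
    terms-sum≡0 : ∀ t → sumℤ (λ j' → β-sum j' * act B W (α j') t) ≡ +0
    terms-sum≡0 t = ℤₚ.≤-antisym (sumℤ-nonPos _ (terms≤0 t))
                                 (subst (+0 ℤ.≤_) (act-α-expansion B W β-sum t) (Wβ-sum≥0 t))
    vanishes : ∀ t → act B W (α j) t ≡ +0
    vanishes t = begin
      act B W (α j) t                ≡⟨ ℤₚ.*-identityˡ _ ⟨
      + 1 * act B W (α j) t          ≡⟨ cong (_* act B W (α j) t) (trans (cong (α i) ρj≡i) (α-self i)) ⟨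
      β-sum j * act B W (α j) t      ≡⟨ sumℤ-nonPos-zero _ (terms≤0 t) (terms-sum≡0 t) j ⟩
      +0                             ∎
      where open ≡-Reasoning

  B-orbit : ∀ {j t} → ρ t ≡ ρ j → B t j ≡ + 2 * α j t
  B-orbit {j} {t} ρt≡ρj with t ≟ j
  ... | yes refl = B-diag t
  ... | no t≢j   = π-admissible t j ρt≡ρj t≢j

  orbitReflection-sref-α : ∀ {i j} → ρ j ≡ i → orbitReflection i (sref B j (α j)) ≗ α j
  orbitReflection-sref-α {i} {j} ρj≡i t with ρ t ≟ i
  ... | no ρt≢i = sref-other B (α j) (λ t≡j → ρt≢i (trans (cong ρ t≡j) ρj≡i))
  ... | yes ρt≡i = begin
    sref B j (α j) t - pairing B t (sref B j (α j))
      ≡⟨ cong₂ _-_ (sref-negates-α j t) (pairing-sref B t j (α j)) ⟩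
    ℤ.-1ℤ * α j t - (pairing B t (α j) - pairing B j (α j) * B t j)
      ≡⟨ cong₂ (λ x y → ℤ.-1ℤ * α j t - (x - y * B t j)) (pairing-α B t j) (trans (pairing-α B j j) (B-diag j)) ⟩
    ℤ.-1ℤ * α j t - (B t j - + 2 * B t j)
      ≡⟨ cong (λ b → ℤ.-1ℤ * α j t - (b - + 2 * b)) (B-orbit (trans ρt≡i (sym ρj≡i))) ⟩
    ℤ.-1ℤ * α j t - (+ 2 * α j t - + 2 * (+ 2 * α j t))              ≡⟨ collapse (α j t) ⟩
    α j t                                                           ∎
    where
    open ≡-Reasoning
    collapse : ∀ a → ℤ.-1ℤ * a - (+ 2 * a - + 2 * (+ 2 * a)) ≡ a
    collapse = solve-∀

  cover-f : ∀ {v i j} → ρ j ≡ i → Cover A v i → Cover B (f v) j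
  cover-f {v} {i} {j} ρj≡i v≺iv =
    nonNeg⇒cover {f v} {j} (nonNeg-unfold v ρj≡i (Positivity.cover⇒nonNeg A A-isGCM {v} {i} v≺iv))

  cover-sⱼf : ∀ {v i j} → ρ j ≡ i → Cover A v i → Cover B (j ∷ f (i ∷ v)) j
  cover-sⱼf {v} {i} {j} ρj≡i v≺iv = nonNeg⇒cover {j ∷ f (i ∷ v)} {j} λ t →
    subst (+0 ℤ.≤_) (sym (same-root t)) (nonNeg-unfold v ρj≡i (Positivity.cover⇒nonNeg A A-isGCM {v} {i} v≺iv) t)
    where
    open ≡-Reasoning
    same-root : act B (reverse (j ∷ f (i ∷ v))) (α j) ≗ act B (reverse (f v)) (α j)
    same-root t = begin
      act B (reverse (j ∷ f (i ∷ v))) (α j) t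
        ≡⟨ cong (λ μ → μ t) (act-reverse-∷ B j (f (i ∷ v)) (α j)) ⟩
      act B (reverse (f (i ∷ v))) (sref B j (α j)) t                 ≡⟨ act-reverse-f-∷ i v (sref B j (α j)) t ⟩
      act B (reverse (f v)) (orbitReflection i (sref B j (α j))) t
        ≡⟨ act-cong B (reverse (f v)) (orbitReflection-sref-α ρj≡i) t ⟩
      act B (reverse (f v)) (α j) t                                  ∎

cover⇒edge : ∀ {m} {C : Matrix m} {K : Fin m → ℕ} {x y : Word m} {k} →
             y ≈[ C ] (k ∷ x) → Cover C x k → EdgeMult C K x y (K k)
cover⇒edge y≈kx x≺kx = inj₁ (_ , y≈kx , x≺kx , refl)

proposition4p9 : ∀ {m n} (F : Folding m n) → let open Folding F in
    (K : Fin n → ℕ) → InZPlus A K →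
    (v : Word n) (i : Fin n) → Cover A v i →
    (j : Fin m) → ρ j ≡ i →
    Σ[ c ∈ ℕ ] (EdgeMult A K v (i ∷ v) c
              × EdgeMult B (φ K) (f v) (j ∷ f v) c
              × EdgeMult B (φ K) (j ∷ f (i ∷ v)) (f (i ∷ v)) c)
proposition4p9 F K _ v i v≺iv j refl =
  K i , cover⇒edge {C = A} {K} {v} {i ∷ v} (λ _ _ → refl) v≺iv
      , cover⇒edge {C = B} {φ K} {f v} {j ∷ f v} (λ _ _ → refl) (cover-f {v} refl v≺iv)
      , cover⇒edge {C = B} {φ K} {j ∷ f (i ∷ v)} {f (i ∷ v)}
                   (λ μ t → sym (sref-involutive j (act B (f (i ∷ v)) μ) t)) (cover-sⱼf {v} refl v≺iv)
  where
  open Folding F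
  open Unfolding F
  open WeylGroup B (IsGCM.diag B-GCM) using (sref-involutive)
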